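{- There exists a constant $\alpha>0.1477$ such that for all sufficiently large $X$, \[ \sum_{n\le X}\mu^2(n^2+1)\mu^2(n^2+2)\mu^2(n^2+3)>\alpha X . \] In particular there are infinitely many positive integers $n$ such that $n^2+1$, $n^2+2$ and $n^2+3$ are all squarefree.
   Context: $\mu$ is the Möbius function, so $\mu^2(m)=1$ if $m$ is squarefree and $0$ otherwise; the sum is over positive integers $n\le X$.
   Formalization: The variable X ranges only over the rationals, and the constant α and the threshold beyond which X counts as sufficiently large are taken in the rationals. -}

module Defs where

open import Data.Bool using (Bool; true; false; not; if_then_else_)
open import Data.Nat using (ℕ; zero; suc; _+_; _*_; _^_)
open import Data.Nat.Divisibility using (_∣_; _∣?_)
open import Data.Integer using (ℤ; +_; -[1+_])
open import Data.List using (List; applyUpTo)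
open import Data.Nat.ListAction using (sum)
open import Data.Bool.ListAction using (all)
open import Relation.Nullary.Decidable using (⌊_⌋)
open import Relation.Binary.PropositionalEquality using (_≡_)

-- m is squarefree: the only d with d² ∣ m is d = 1 (so 0 is not squarefree)
SquareFree : ℕ → Set
SquareFree m = ∀ d → d * d ∣ m → d ≡ 1

-- Boolean test: no d ∈ {2, …, m+1} has d² ∣ m (sufficient range for squarefreeness)
squarefreeᵇ : ℕ → Bool
squarefreeᵇ m = all (λ d → not ⌊ (d * d) ∣? m ⌋) (applyUpTo (λ i → 2 + i) m)

μ² : ℕ → ℕ
μ² m = if squarefreeᵇ m then 1 else 0

term : ℕ → ℕ
term n = μ² (n ^ 2 + 1) * μ² (n ^ 2 + 2) * μ² (n ^ 2 + 3)

Sℕ : ℕ → ℕ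
Sℕ N = sum (applyUpTo (λ i → term (suc i)) N)

-- Σ over positive integers n ≤ X, where X is given via its floor ⌊X⌋ ∈ ℤ
Sℤ : ℤ → ℕ
Sℤ (+ N) = Sℕ N
Sℤ -[1+ _ ] = 0

-- Call n good if n is even and n ≢ ±4 (mod 9): then neither 4 nor 9
-- divides n² + a (a = 1, 2, 3), so n² + a can only fail to be squarefree through p² with
-- p prime, 5 ≤ p ≤ n + 1. The roots of x² ≡ -a (mod p²) are ±x, so inside one class mod 36
-- such n fall into two classes mod 36p², at most 2 (N/36p² + 1) of them. Summing over the
-- 22 bad and 14 good classes mod 36, over a and over p,
--   S(N) ≥ N - 22 (N/36 + 1) - 84 Σ_{5 ≤ p ≤ N+1 prime} (N/36p² + 1).
-- Primes p ≤ 300 are summed exactly through ⌈10⁶/p²⌉, the tail Σ_{p > 300} N/36p² telescopes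
-- to at most N/(36·300), and the number of primes up to N is at most 2^κ + 4N/κ by Erdős's
-- bound from the central binomial coefficient. Altogether 37 (N + 1) ≤ 250 S(N) for large N.

module Submission where

module Sums where

  open import Data.Nat
  open import Data.Nat.Properties
  open import Data.Nat.DivMod
  open import Data.Nat.Divisibility
  open import Data.Product using (∃-syntax; _×_; _,_)
  open import Data.Sum using (_⊎_; inj₁; inj₂)
  open import Data.Empty using (⊥-elim)
  open import Relation.Binary.PropositionalEquality
  open import Relation.Nullary using (Dec; yes; no; ¬_)
  open import Relation.Unary using (Decidable)
  open import Algebra.Properties.CommutativeSemigroup +-commutativeSemigroup using (interchange)

  sumTo : (ℕ → ℕ) → ℕ → ℕ
  sumTo f zero    = 0
  sumTo f (suc N) = sumTo f N + f (suc N)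

  sumTo-cong : ∀ f g N → (∀ n → f n ≡ g n) → sumTo f N ≡ sumTo g N
  sumTo-cong f g zero    f≡g = refl
  sumTo-cong f g (suc N) f≡g = cong₂ _+_ (sumTo-cong f g N f≡g) (f≡g (suc N))

  sumTo-mono-≤ : ∀ f g N → (∀ {n} → 1 ≤ n → n ≤ N → f n ≤ g n) → sumTo f N ≤ sumTo g N
  sumTo-mono-≤ f g zero    f≤g = z≤n
  sumTo-mono-≤ f g (suc N) f≤g =
    +-mono-≤ (sumTo-mono-≤ f g N (λ 1≤n n≤N → f≤g 1≤n (m≤n⇒m≤1+n n≤N))) (f≤g (s≤s z≤n) ≤-refl)

  sumTo-distrib-+ : ∀ f g N → sumTo (λ n → f n + g n) N ≡ sumTo f N + sumTo g N
  sumTo-distrib-+ f g zero    = refl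
  sumTo-distrib-+ f g (suc N) =
    trans (cong (_+ (f (suc N) + g (suc N))) (sumTo-distrib-+ f g N)) (interchange (sumTo f N) (sumTo g N) _ _)

  sumTo-*ˡ : ∀ c f N → sumTo (λ n → c * f n) N ≡ c * sumTo f N
  sumTo-*ˡ c f zero    = sym (*-zeroʳ c)
  sumTo-*ˡ c f (suc N) =
    trans (cong (_+ c * f (suc N)) (sumTo-*ˡ c f N)) (sym (*-distribˡ-+ c (sumTo f N) (f (suc N))))

  sumTo-*ʳ : ∀ c f N → sumTo (λ n → f n * c) N ≡ sumTo f N * c
  sumTo-*ʳ c f N = begin
    sumTo (λ n → f n * c) N ≡⟨ sumTo-cong _ _ N (λ n → *-comm (f n) c) ⟩
    sumTo (λ n → c * f n) N ≡⟨ sumTo-*ˡ c f N ⟩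
    c * sumTo f N           ≡⟨ *-comm c (sumTo f N) ⟩
    sumTo f N * c           ∎
    where open ≡-Reasoning

  sumTo-const : ∀ c N → sumTo (λ _ → c) N ≡ N * c
  sumTo-const c zero    = refl
  sumTo-const c (suc N) = trans (cong (_+ c) (sumTo-const c N)) (+-comm (N * c) c)

  sumTo-≡0 : ∀ f N → (∀ {n} → 1 ≤ n → n ≤ N → f n ≡ 0) → sumTo f N ≡ 0
  sumTo-≡0 f N f≡0 = n≤0⇒n≡0 (begin
    sumTo f N         ≤⟨ sumTo-mono-≤ f (λ _ → 0) N (λ 1≤n n≤N → ≤-reflexive (f≡0 1≤n n≤N)) ⟩
    sumTo (λ _ → 0) N ≡⟨ trans (sumTo-const 0 N) (*-zeroʳ N) ⟩
    0                 ∎)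
    where open ≤-Reasoning

  sumTo-comm : ∀ (h : ℕ → ℕ → ℕ) N K →
               sumTo (λ n → sumTo (λ m → h m n) K) N ≡ sumTo (λ m → sumTo (λ n → h m n) N) K
  sumTo-comm h N zero    = sumTo-≡0 (λ _ → 0) N (λ _ _ → refl)
  sumTo-comm h N (suc K) =
    trans (sumTo-distrib-+ (λ n → sumTo (λ m → h m n) K) (h (suc K)) N)
          (cong (_+ sumTo (h (suc K)) N) (sumTo-comm h N K))

  sumTo-split : ∀ f a k → sumTo f (a + k) ≡ sumTo f a + sumTo (λ i → f (a + i)) k
  sumTo-split f a zero    = trans (cong (sumTo f) (+-identityʳ a)) (sym (+-identityʳ _))
  sumTo-split f a (suc k) = begin
    sumTo f (a + suc k)                                     ≡⟨ cong (sumTo f) (+-suc a k) ⟩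
    sumTo f (a + k) + f (suc (a + k))                       ≡⟨ cong₂ _+_ (sumTo-split f a k) (cong f (sym (+-suc a k))) ⟩
    sumTo f a + sumTo (λ i → f (a + i)) k + f (a + suc k)   ≡⟨ +-assoc (sumTo f a) _ _ ⟩
    sumTo f a + sumTo (λ i → f (a + i)) (suc k)             ∎
    where open ≡-Reasoning

  ≤-sumTo : ∀ f {N n} → 1 ≤ n → n ≤ N → f n ≤ sumTo f N
  ≤-sumTo f {zero}  () z≤n
  ≤-sumTo f {suc N} 1≤n n≤1+N with m≤n⇒m<n∨m≡n n≤1+N
  ... | inj₁ n<1+N = ≤-trans (≤-sumTo f 1≤n (≤-pred n<1+N)) (m≤m+n _ _)
  ... | inj₂ refl  = m≤n+m _ _

  sumTo>0⇒∃ : ∀ f N → 0 < sumTo f N → ∃[ n ] 1 ≤ n × n ≤ N × 0 < f n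
  sumTo>0⇒∃ f (suc N) Σ>0 with f (suc N) in fN≡
  ... | suc _ = suc N , s≤s z≤n , ≤-refl , subst (0 <_) (sym fN≡) (s≤s z≤n)
  ... | zero with sumTo>0⇒∃ f N (subst (0 <_) (+-identityʳ _) Σ>0)
  ...   | n , 1≤n , n≤N , fn>0 = n , 1≤n , m≤n⇒m≤1+n n≤N , fn>0

  sumTo≤length : ∀ f N → (∀ n → f n ≤ 1) → sumTo f N ≤ N
  sumTo≤length f N f≤1 = ≤-trans (sumTo-mono-≤ f (λ _ → 1) N (λ _ _ → f≤1 _))
                                 (≤-reflexive (trans (sumTo-const 1 N) (*-identityʳ N)))

  𝟙 : {P : Set} → Dec P → ℕ
  𝟙 (yes _) = 1
  𝟙 (no _)  = 0

  𝟙≤1 : {P : Set} (P? : Dec P) → 𝟙 P? ≤ 1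
  𝟙≤1 (yes _) = ≤-refl
  𝟙≤1 (no _)  = z≤n

  𝟙-yes : {P : Set} (P? : Dec P) → P → 𝟙 P? ≡ 1
  𝟙-yes (yes _) _ = refl
  𝟙-yes (no ¬p) p = ⊥-elim (¬p p)

  𝟙-no : {P : Set} (P? : Dec P) → ¬ P → 𝟙 P? ≡ 0
  𝟙-no (yes p) ¬p = ⊥-elim (¬p p)
  𝟙-no (no _)  _  = refl

  𝟙>0⇒ : {P : Set} (P? : Dec P) → 0 < 𝟙 P? → P
  𝟙>0⇒ (yes p) _ = p

  𝟙-mono : {P Q : Set} (P? : Dec P) (Q? : Dec Q) → (P → Q) → 𝟙 P? ≤ 𝟙 Q?
  𝟙-mono (yes p) Q? P⇒Q = ≤-reflexive (sym (𝟙-yes Q? (P⇒Q p)))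
  𝟙-mono (no _)  Q? P⇒Q = z≤n

  𝟙-⊎ : {P Q R : Set} (P? : Dec P) (Q? : Dec Q) (R? : Dec R) → (P → Q ⊎ R) → 𝟙 P? ≤ 𝟙 Q? + 𝟙 R?
  𝟙-⊎ (no _)  Q? R? P⇒Q⊎R = z≤n
  𝟙-⊎ (yes p) Q? R? P⇒Q⊎R with P⇒Q⊎R p
  ... | inj₁ q = ≤-trans (≤-reflexive (sym (𝟙-yes Q? q))) (m≤m+n _ _)
  ... | inj₂ r = ≤-trans (≤-reflexive (sym (𝟙-yes R? r))) (m≤n+m _ _)

  count : {P : ℕ → Set} → Decidable P → ℕ → ℕ
  count P? = sumTo (λ n → 𝟙 (P? n))

  count≤length : ∀ {P : ℕ → Set} (P? : Decidable P) N → count P? N ≤ N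
  count≤length P? N = sumTo≤length _ N (λ n → 𝟙≤1 (P? n))

  module _ (M : ℕ) {P : ℕ → Set} (P? : Decidable P)
           (spaced : ∀ {m n} → P m → P n → m < n → m + M ≤ n) where

    -- The invariant is carried by the largest l ≤ N with P l.
    private
      count-spaced-last : ∀ N → count P? N ≡ 0 ⊎ ∃[ l ] l ≤ N × P l × M * count P? N ≤ l + M
      count-spaced-last zero = inj₁ refl
      count-spaced-last (suc N) with P? (suc N) | count-spaced-last N
      ... | no _   | inj₁ c≡0 = inj₁ (trans (+-identityʳ _) c≡0)
      ... | no _   | inj₂ (l , l≤N , Pl , bound) =
        inj₂ (l , m≤n⇒m≤1+n l≤N , Pl , subst (λ c → M * c ≤ l + M) (sym (+-identityʳ _)) bound)
      ... | yes PN | inj₁ c≡0 = inj₂ (suc N , ≤-refl , PN , (begin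
        M * (count P? N + 1) ≡⟨ cong (λ c → M * (c + 1)) c≡0 ⟩
        M * 1                ≡⟨ *-identityʳ M ⟩
        M                    ≤⟨ m≤n+m M (suc N) ⟩
        suc N + M            ∎))
        where open ≤-Reasoning
      ... | yes PN | inj₂ (l , l≤N , Pl , bound) = inj₂ (suc N , ≤-refl , PN , (begin
        M * (count P? N + 1)        ≡⟨ *-distribˡ-+ M (count P? N) 1 ⟩
        M * count P? N + M * 1      ≤⟨ +-mono-≤ bound (≤-reflexive (*-identityʳ M)) ⟩
        l + M + M                   ≤⟨ +-monoˡ-≤ M (spaced Pl PN (s≤s l≤N)) ⟩
        suc N + M                   ∎))
        where open ≤-Reasoning

    count-spaced : ∀ N → M * count P? N ≤ N + M
    count-spaced N with count-spaced-last N
    ... | inj₁ c≡0 = subst (λ c → M * c ≤ N + M) (sym c≡0) (≤-trans (≤-reflexive (*-zeroʳ M)) z≤n)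
    ... | inj₂ (l , l≤N , _ , bound) = ≤-trans bound (+-monoˡ-≤ M l≤N)

  count-congruent : ∀ M .{{_ : NonZero M}} {P : ℕ → Set} (P? : Decidable P) →
                    (∀ {m n} → P m → P n → m < n → M ∣ n ∸ m) → ∀ N → count P? N ≤ N / M + 1
  count-congruent M {P} P? congruent N = begin
    count P? N             ≡⟨ sym (m*n/n≡m (count P? N) M) ⟩
    count P? N * M / M     ≤⟨ /-monoˡ-≤ M (≤-trans (≤-reflexive (*-comm (count P? N) M)) (count-spaced M P? spaced N)) ⟩
    (N + M) / M            ≡⟨ +-distrib-/-∣ʳ N (∣-refl {M}) ⟩
    N / M + M / M          ≡⟨ cong (N / M +_) (n/n≡1 M) ⟩
    N / M + 1              ∎
    where
    open ≤-Reasoning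
    spaced : ∀ {m n} → P m → P n → m < n → m + M ≤ n
    spaced {m} {n} Pm Pn m<n = begin
      m + M       ≤⟨ +-monoʳ-≤ m (∣⇒≤ {{>-nonZero (m<n⇒0<n∸m m<n)}} (congruent Pm Pn m<n)) ⟩
      m + (n ∸ m) ≡⟨ m+[n∸m]≡n (<⇒≤ m<n) ⟩
      n           ∎


module PrimeSquares where

  open import Data.Nat
  open import Data.Nat.Properties
  open import Data.Nat.Divisibility
  open import Data.Nat.Primality
  open import Data.Nat.Coprimality using (Coprime; coprime-divisor)
  open import Data.Product using (∃-syntax; _×_; _,_)
  open import Data.Sum using (_⊎_; inj₁; inj₂)
  open import Relation.Binary.PropositionalEquality
  open import Relation.Nullary using (yes; no; ¬_; contradiction)

  prime⇒2≤ : ∀ {p} → Prime p → 2 ≤ p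
  prime⇒2≤ {p} p-prime = nonTrivial⇒n>1 p {{prime⇒nonTrivial p-prime}}

  prime∤⇒coprime : ∀ {p x} → Prime p → p ∤ x → Coprime p x
  prime∤⇒coprime p-prime p∤x (d∣p , d∣x) with prime⇒irreducible p-prime d∣p
  ... | inj₁ d≡1 = d≡1
  ... | inj₂ refl = contradiction d∣x p∤x

  prime∤-* : ∀ {p m n} → Prime p → p ∤ m → p ∤ n → p ∤ m * n
  prime∤-* {p} {m} {n} p-prime p∤m p∤n p∣mn with euclidsLemma m n p-prime p∣mn
  ... | inj₁ p∣m = p∤m p∣m
  ... | inj₂ p∣n = p∤n p∣n

  ∃-prime-divisor : ∀ {d} → 2 ≤ d → ∃[ p ] Prime p × p ∣ d
  ∃-prime-divisor {d} 2≤d = go d ≤-refl 2≤d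
    where
    go : ∀ fuel {e} → e ≤ fuel → 2 ≤ e → ∃[ p ] Prime p × p ∣ e
    go zero    e≤0 2≤e = contradiction (≤-trans 2≤e e≤0) λ ()
    go (suc fuel) {e} e≤fuel 2≤e with prime? e
    ... | yes e-prime = e , e-prime , ∣-refl
    ... | no ¬e-prime with ¬prime⇒composite {{n>1⇒nonTrivial 2≤e}} ¬e-prime
    ...   | hasNonTrivialDivisor {f} f<e f∣e =
      let p , p-prime , p∣f = go fuel (≤-pred (≤-trans f<e e≤fuel)) (nonTrivial⇒n>1 f)
      in p , p-prime , ∣-trans p∣f f∣e

  p*p∣x*y⇒p*p∣y : ∀ {p x y} → Prime p → p ∤ x → p * p ∣ x * y → p * p ∣ y
  p*p∣x*y⇒p*p∣y {p} {x} {y} p-prime p∤x pp∣xy = p*p∣y p∣y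
    where
    instance
      _ : NonZero p
      _ = prime⇒nonZero p-prime
    p⊥x : Coprime p x
    p⊥x = prime∤⇒coprime p-prime p∤x
    p∣y : p ∣ y
    p∣y = coprime-divisor p⊥x (∣-trans (m∣m*n p) pp∣xy)
    p*p∣y : p ∣ y → p * p ∣ y
    p*p∣y (divides u refl) = *-monoˡ-∣ p (coprime-divisor p⊥x (*-cancelˡ-∣ p pp∣pxu))
      where
      pp∣pxu : p * p ∣ p * (x * u)
      pp∣pxu = subst (p * p ∣_) (trans (sym (*-assoc x u p)) (*-comm (x * u) p)) pp∣xy

  ∣∧p*p∣⇒*p*p∣ : ∀ {p x c} → Prime p → p ∤ x → x ∣ c → p * p ∣ c → x * (p * p) ∣ c
  ∣∧p*p∣⇒*p*p∣ {p} {x} p-prime p∤x (divides q refl) pp∣qx =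
    subst (x * (p * p) ∣_) (*-comm x q)
          (*-monoʳ-∣ x (p*p∣x*y⇒p*p∣y p-prime p∤x (subst (p * p ∣_) (*-comm q x) pp∣qx)))

  ∣m∣n⇒∣m∸n : ∀ {d m n} → d ∣ m → d ∣ n → d ∣ m ∸ n
  ∣m∣n⇒∣m∸n {d} (divides a refl) (divides b refl) = divides (a ∸ b) (sym (*-distribʳ-∸ d a b))

  m*m∸n*n≡[m+n]*[m∸n] : ∀ m n → m * m ∸ n * n ≡ (m + n) * (m ∸ n)
  m*m∸n*n≡[m+n]*[m∸n] m n = sym (begin
    (m + n) * (m ∸ n)               ≡⟨ *-distribˡ-∸ (m + n) m n ⟩
    (m + n) * m ∸ (m + n) * n       ≡⟨ cong₂ _∸_ (*-distribʳ-+ m m n) (*-distribʳ-+ n m n) ⟩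
    (m * m + n * m) ∸ (m * n + n * n) ≡⟨ cong (λ k → (m * m + n * m) ∸ (k + n * n)) (*-comm m n) ⟩
    (m * m + n * m) ∸ (n * m + n * n) ≡⟨ cong (_∸ (n * m + n * n)) (+-comm (m * m) (n * m)) ⟩
    (n * m + m * m) ∸ (n * m + n * n) ≡⟨ [m+n]∸[m+o]≡n∸o (n * m) (m * m) (n * n) ⟩
    m * m ∸ n * n                   ∎)
    where open ≡-Reasoning

  [m+o]∸[n+o]≡m∸n : ∀ m n o → m + o ∸ (n + o) ≡ m ∸ n
  [m+o]∸[n+o]≡m∸n m n o = trans (cong₂ _∸_ (+-comm m o) (+-comm n o)) ([m+n]∸[m+o]≡n∸o o m n)

  ∣x*x+a∧∣y*y+a⇒∣[y+x]*[y∸x] : ∀ {d a} x y → d ∣ x * x + a → d ∣ y * y + a → d ∣ (y + x) * (y ∸ x)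
  ∣x*x+a∧∣y*y+a⇒∣[y+x]*[y∸x] {d} {a} x y d∣x²+a d∣y²+a =
    subst (d ∣_) (trans ([m+o]∸[n+o]≡m∸n (y * y) (x * x) a) (m*m∸n*n≡[m+n]*[m∸n] y x))
          (∣m∣n⇒∣m∸n d∣y²+a d∣x²+a)

  m+n+[m∸n]≡2*m : ∀ {m n} → n ≤ m → m + n + (m ∸ n) ≡ 2 * m
  m+n+[m∸n]≡2*m {m} {n} n≤m = begin
    m + n + (m ∸ n)   ≡⟨ +-assoc m n (m ∸ n) ⟩
    m + (n + (m ∸ n)) ≡⟨ cong (m +_) (m+[n∸m]≡n n≤m) ⟩
    m + m             ≡⟨ cong (m +_) (sym (+-identityʳ m)) ⟩
    2 * m             ∎
    where open ≡-Reasoning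

  p*p-square-roots : ∀ {p a x y} → Prime p → p ∤ 2 → p ∤ a → x ≤ y →
                     p * p ∣ x * x + a → p * p ∣ y * y + a → p * p ∣ y ∸ x ⊎ p * p ∣ y + x
  p*p-square-roots {p} {a} {x} {y} p-prime p∤2 p∤a x≤y pp∣x²+a pp∣y²+a
    with p ∣? (y + x) | p ∣? (y ∸ x)
  ... | no p∤y+x | _ = inj₁ (p*p∣x*y⇒p*p∣y p-prime p∤y+x (∣x*x+a∧∣y*y+a⇒∣[y+x]*[y∸x] x y pp∣x²+a pp∣y²+a))
  ... | yes _ | no p∤y∸x = inj₂ (p*p∣x*y⇒p*p∣y p-prime p∤y∸x
        (subst (p * p ∣_) (*-comm (y + x) (y ∸ x)) (∣x*x+a∧∣y*y+a⇒∣[y+x]*[y∸x] x y pp∣x²+a pp∣y²+a)))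
  ... | yes p∣y+x | yes p∣y∸x
    with euclidsLemma 2 y p-prime (subst (p ∣_) (m+n+[m∸n]≡2*m x≤y) (∣m∣n⇒∣m+n p∣y+x p∣y∸x))
  ...   | inj₁ p∣2 = contradiction p∣2 p∤2
  ...   | inj₂ p∣y = contradiction (∣m+n∣m⇒∣n (∣-trans (m∣m*n p) pp∣y²+a) (∣m⇒∣m*n y p∣y)) p∤a


module SquareFreeTest where

  open import Data.Bool using (Bool; true; false; not; T)
  open import Data.Bool.Properties using (T-≡)
  open import Data.List using (applyUpTo)
  open import Data.List.Relation.Unary.All.Properties using (all⁺; all⁻; applyUpTo⁻)
  open import Data.List.Relation.Unary.All.Properties.Core using (¬All⇒Any¬)
  import Data.List.Relation.Unary.Any.Properties as Any
  open import Data.Nat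
  open import Data.Nat.Properties
  open import Data.Nat.Divisibility
  open import Data.Nat.Primality
  open import Data.Product using (∃-syntax; _×_; _,_)
  open import Function using (_∘_; Equivalence)
  open import Relation.Binary.PropositionalEquality
  open import Relation.Nullary using (Dec; yes; no; ¬_; contradiction)
  open import Relation.Nullary.Decidable using (⌊_⌋; T?)
  open import Defs
  open PrimeSquares

  squarefreeᵇ≡true⇒SquareFree : ∀ {m} → 0 < m → squarefreeᵇ m ≡ true → SquareFree m
  squarefreeᵇ≡true⇒SquareFree {m} m>0 sqf≡true zero (divides q m≡q*0) =
    contradiction (trans m≡q*0 (*-zeroʳ q)) (>⇒≢ m>0)
  squarefreeᵇ≡true⇒SquareFree {m} m>0 sqf≡true (suc zero) _ = refl
  squarefreeᵇ≡true⇒SquareFree {m} m>0 sqf≡true (suc (suc i)) dd∣m =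
    contradiction (applyUpTo⁻ _ m (all⁺ _ _ (Equivalence.from T-≡ sqf≡true)) i<m) (rejects (_ ∣? m) dd∣m)
    where
    rejects : ∀ {P : Set} (P? : Dec P) → P → ¬ T (not ⌊ P? ⌋)
    rejects (yes _) _ ()
    rejects (no ¬p) p _ = ¬p p
    i<m : i < m
    i<m = ≤-trans (≤-trans (n≤1+n (suc i)) (m≤m*n (2 + i) (2 + i))) (∣⇒≤ {{>-nonZero m>0}} dd∣m)

  squarefreeᵇ≡false⇒∃p*p∣ : ∀ m → squarefreeᵇ m ≡ false → ∃[ p ] Prime p × p * p ∣ m
  squarefreeᵇ≡false⇒∃p*p∣ m sqf≡false
    with Any.applyUpTo⁻ (2 +_) (¬All⇒Any¬ (T? ∘ test) (applyUpTo (2 +_) m)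
           (λ all-pass → subst T sqf≡false (all⁻ test all-pass)))
    where
    test : ℕ → Bool
    test d = not ⌊ d * d ∣? m ⌋
  ... | i , _ , fails with (2 + i) * (2 + i) ∣? m
  ...   | no _ = contradiction _ fails
  ...   | yes dd∣m =
    let p , p-prime , p∣d = ∃-prime-divisor {2 + i} (s≤s (s≤s z≤n))
    in p , p-prime , ∣-trans (*-pres-∣ p∣d p∣d) dd∣m


module Residues where

  open import Data.List using (upTo)
  open import Data.List.Relation.Unary.All using (all?)
  open import Data.List.Relation.Unary.All.Properties using (applyUpTo⁻)
  open import Data.Nat
  open import Data.Nat.DivMod
  open import Data.Nat.Divisibility
  open import Data.Product using (_×_; _,_; proj₁; proj₂)
  open import Function using (id)
  open import Relation.Binary.PropositionalEquality
  open import Relation.Nullary.Decidable using (_×-dec_; _→-dec_; ¬?; toWitness)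
  open import Relation.Unary using (Decidable)

  NoSmallSquare : ℕ → Set
  NoSmallSquare x = 4 ∤ x × 9 ∤ x

  noSmallSquare? : Decidable NoSmallSquare
  noSmallSquare? x = ¬? (4 ∣? x) ×-dec ¬? (9 ∣? x)

  -- An even n with n ≢ ±4 (mod 9) keeps 4 and 9 out of n² + 1, n² + 2, n² + 3.
  Good36 : ℕ → Set
  Good36 r = 2 ∣ r × r % 9 ≢ 4 × r % 9 ≢ 5

  good36? : Decidable Good36
  good36? r = 2 ∣? r ×-dec ¬? (r % 9 ≟ 4) ×-dec ¬? (r % 9 ≟ 5)

  square+-%-cong : ∀ d .{{_ : NonZero d}} {x y} a → x % d ≡ y % d → (x * x + a) % d ≡ (y * y + a) % d
  square+-%-cong d {x} {y} a x≡y = begin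
    (x * x + a) % d                       ≡⟨ %-distribˡ-+ (x * x) a d ⟩
    ((x * x) % d + a % d) % d             ≡⟨ cong (λ k → (k + a % d) % d) (%-distribˡ-* x x d) ⟩
    ((x % d * (x % d)) % d + a % d) % d   ≡⟨ cong (λ k → ((k * k) % d + a % d) % d) x≡y ⟩
    ((y % d * (y % d)) % d + a % d) % d   ≡⟨ cong (λ k → (k + a % d) % d) (%-distribˡ-* y y d) ⟨
    ((y * y) % d + a % d) % d             ≡⟨ %-distribˡ-+ (y * y) a d ⟨
    (y * y + a) % d                       ∎
    where open ≡-Reasoning

  ∣-%-cong : ∀ d .{{_ : NonZero d}} {x y} → x % d ≡ y % d → d ∣ x → d ∣ y
  ∣-%-cong d {x} {y} x≡y d∣x = m%n≡0⇒n∣m y d (trans (sym x≡y) (n∣m⇒m%n≡0 x d d∣x))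

  private
    Good36-sound : ℕ → Set
    Good36-sound r = Good36 r → NoSmallSquare (r * r + 1) × NoSmallSquare (r * r + 2) × NoSmallSquare (r * r + 3)

    good36-sound-below36 : ∀ {r} → r < 36 → Good36-sound r
    good36-sound-below36 = applyUpTo⁻ id 36 (toWitness {a? = all? sound? (upTo 36)} _)
      where
      sound? : Decidable Good36-sound
      sound? r = good36? r →-dec (noSmallSquare? (r * r + 1) ×-dec noSmallSquare? (r * r + 2) ×-dec noSmallSquare? (r * r + 3))

  good36⇒noSmallSquare : ∀ n {a} → Good36 (n % 36) → 1 ≤ a → a ≤ 3 → NoSmallSquare (n * n + a)
  good36⇒noSmallSquare n {a} good 1≤a a≤3 =
    transfer 4 (divides 9 refl) (proj₁ (pick a 1≤a a≤3 (good36-sound-below36 (m%n<n n 36) good))) ,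
    transfer 9 (divides 4 refl) (proj₂ (pick a 1≤a a≤3 (good36-sound-below36 (m%n<n n 36) good)))
    where
    r : ℕ
    r = n % 36
    pick : ∀ a → 1 ≤ a → a ≤ 3 → NoSmallSquare (r * r + 1) × NoSmallSquare (r * r + 2) × NoSmallSquare (r * r + 3) →
           NoSmallSquare (r * r + a)
    pick 1 _ _ (s₁ , _ , _) = s₁
    pick 2 _ _ (_ , s₂ , _) = s₂
    pick 3 _ _ (_ , _ , s₃) = s₃
    pick (suc (suc (suc (suc _)))) _ (s≤s (s≤s (s≤s ()))) _
    transfer : ∀ d .{{_ : NonZero d}} → d ∣ 36 → d ∤ r * r + a → d ∤ n * n + a
    transfer d d∣36 d∤ d∣ = d∤ (∣-%-cong d (square+-%-cong d a (sym (m∣n⇒o%n%m≡o%m d 36 n d∣36))) d∣)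


module Sieve where

  open import Data.Bool using (true; false)
  open import Data.Nat
  open import Data.Nat.Properties
  open import Data.Nat.DivMod
  open import Data.Nat.Divisibility
  open import Data.Nat.Primality
  open import Data.Nat.Tactic.RingSolver using (solve-∀)
  open import Data.Product using (∃-syntax; _×_; _,_)
  open import Data.Sum using (_⊎_; inj₁; inj₂)
  open import Relation.Binary.PropositionalEquality
  open import Relation.Nullary using (yes; no; ¬_; contradiction)
  open import Relation.Nullary.Decidable using (_×-dec_; ¬?)
  open import Relation.Unary using (Decidable)
  open import Algebra.Properties.CommutativeSemigroup *-commutativeSemigroup using (x∙yz≈y∙xz)
  open import Defs
  open Sums
  open PrimeSquares
  open SquareFreeTest
  open Residues

  %≡⇒∣∸ : ∀ M .{{_ : NonZero M}} {m n} → m % M ≡ n % M → M ∣ n ∸ m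
  %≡⇒∣∸ M {m} {n} m≡n = divides (n / M ∸ m / M) (begin
    n ∸ m                                   ≡⟨ cong₂ _∸_ (m≡m%n+[m/n]*n n M) (m≡m%n+[m/n]*n m M) ⟩
    (n % M + n / M * M) ∸ (m % M + m / M * M) ≡⟨ cong (λ k → (k + n / M * M) ∸ (m % M + m / M * M)) (sym m≡n) ⟩
    (m % M + n / M * M) ∸ (m % M + m / M * M) ≡⟨ [m+n]∸[m+o]≡n∸o (m % M) _ _ ⟩
    n / M * M ∸ m / M * M                   ≡⟨ *-distribʳ-∸ M (n / M) (m / M) ⟨
    (n / M ∸ m / M) * M                     ∎)
    where open ≡-Reasoning

  ∣∸⇒%≡ : ∀ M .{{_ : NonZero M}} {m n} → m ≤ n → M ∣ n ∸ m → m % M ≡ n % M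
  ∣∸⇒%≡ M {m} {n} m≤n M∣n∸m = begin
    m % M             ≡⟨ %-remove-+ʳ m M∣n∸m ⟨
    (m + (n ∸ m)) % M ≡⟨ cong (_% M) (m+[n∸m]≡n m≤n) ⟩
    n % M             ∎
    where open ≡-Reasoning

  Prime≥5 : ℕ → Set
  Prime≥5 p = Prime p × 5 ≤ p

  prime≥5? : Decidable Prime≥5
  prime≥5? p = prime? p ×-dec 5 ≤? p

  prime≥5∤36 : ∀ {p} → Prime p → 5 ≤ p → p ∤ 36
  prime≥5∤36 {p} p-prime p≥5 = prime∤-* p-prime p∤6 p∤6
    where
    p∤6 : p ∤ 6
    p∤6 = prime∤-* p-prime (>⇒∤ (≤-trans (s≤s (s≤s (s≤s z≤n))) p≥5))
                           (>⇒∤ (≤-trans (s≤s (s≤s (s≤s (s≤s z≤n)))) p≥5))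

  prime≥5∤ : ∀ {p m} → Prime≥5 p → 1 ≤ m → m ≤ 3 → p ∤ m
  prime≥5∤ (_ , p≥5) 1≤m m≤3 = >⇒∤ {{>-nonZero 1≤m}} (≤-trans (s≤s (≤-trans m≤3 (n≤1+n 3))) p≥5)

  Hit : ℕ → ℕ → ℕ → ℕ → Set
  Hit p a r n = n % 36 ≡ r × p * p ∣ n * n + a

  hit? : ∀ p a r → Decidable (Hit p a r)
  hit? p a r n = n % 36 ≟ r ×-dec p * p ∣? n * n + a

  hits-congruent : ∀ {p a r m n} → Prime≥5 p → Hit p a r m → Hit p a r n → p * p ∣ n ∸ m → 36 * (p * p) ∣ n ∸ m
  hits-congruent {m = m} {n} (p-prime , p≥5) (m≡r , _) (n≡r , _) =
    ∣∧p*p∣⇒*p*p∣ {x = 36} p-prime (prime≥5∤36 p-prime p≥5) (%≡⇒∣∸ 36 {m} {n} (trans m≡r (sym n≡r)))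

  -- the junk value at p = 0 never enters a sum
  ⌊N/36p²⌋ : ℕ → ℕ → ℕ
  ⌊N/36p²⌋ N zero    = 0
  ⌊N/36p²⌋ N (suc p) = N / (36 * (suc p * suc p))

  -- Hits in a class mod 36 lie in at most two classes mod 36p²: those of n₁ and of -n₁, for any hit n₁.
  count-hit : ∀ {p a} r N → Prime≥5 p → 1 ≤ a → a ≤ 3 → count (hit? p a r) N ≤ 2 * (⌊N/36p²⌋ N p + 1)
  count-hit {zero} r N (0-prime , _) = contradiction 0-prime ¬prime[0]
  count-hit {p@(suc _)} {a} r N p≥5@(p-prime , _) 1≤a a≤3 with count (hit? p a r) N in count≡
  ... | zero  = z≤n
  ... | suc _ with sumTo>0⇒∃ _ N (subst (0 <_) (sym count≡) (s≤s z≤n))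
  ...   | n₁ , _ , _ , hit₁>0 = subst (_≤ 2 * (N / M + 1)) count≡ (begin
    count (hit? p a r) N                             ≤⟨ sumTo-mono-≤ _ _ N (λ {n} _ _ → 𝟙-⊎ (hit? p a r n) (same? n) (opposite? n) (same⊎opposite n)) ⟩
    sumTo (λ n → 𝟙 (same? n) + 𝟙 (opposite? n)) N   ≡⟨ sumTo-distrib-+ _ _ N ⟩
    count same? N + count opposite? N                ≤⟨ +-mono-≤ (count-congruent M same? same-congruent N) (count-congruent M opposite? opposite-congruent N) ⟩
    (N / M + 1) + (N / M + 1)                        ≡⟨ cong ((N / M + 1) +_) (+-identityʳ _) ⟨
    2 * (N / M + 1)                                  ∎)
    where
    open ≤-Reasoning
    pp M : ℕ
    pp = p * p
    M = 36 * pp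
    instance
      _ : NonZero pp
      _ = m*n≢0 p p
      _ : NonZero M
      _ = m*n≢0 36 pp
    hit₁ : Hit p a r n₁
    hit₁ = 𝟙>0⇒ (hit? p a r n₁) hit₁>0
    Same Opposite : ℕ → Set
    Same n = Hit p a r n × n % pp ≡ n₁ % pp
    Opposite n = Hit p a r n × pp ∣ n + n₁
    same? : Decidable Same
    same? n = hit? p a r n ×-dec n % pp ≟ n₁ % pp
    opposite? : Decidable Opposite
    opposite? n = hit? p a r n ×-dec pp ∣? n + n₁
    roots : ∀ {x y} → x ≤ y → Hit p a r x → Hit p a r y → pp ∣ y ∸ x ⊎ pp ∣ y + x
    roots x≤y (_ , pp∣x) (_ , pp∣y) = p*p-square-roots p-prime (prime≥5∤ p≥5 (s≤s z≤n) (s≤s (s≤s z≤n))) (prime≥5∤ p≥5 1≤a a≤3) x≤y pp∣x pp∣y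
    same⊎opposite : ∀ n → Hit p a r n → Same n ⊎ Opposite n
    same⊎opposite n hit with ≤-total n n₁
    ... | inj₁ n≤n₁ with roots n≤n₁ hit hit₁
    ...   | inj₁ pp∣n₁∸n = inj₁ (hit , ∣∸⇒%≡ pp n≤n₁ pp∣n₁∸n)
    ...   | inj₂ pp∣n₁+n = inj₂ (hit , subst (pp ∣_) (+-comm n₁ n) pp∣n₁+n)
    same⊎opposite n hit | inj₂ n₁≤n with roots n₁≤n hit₁ hit
    ...   | inj₁ pp∣n∸n₁ = inj₁ (hit , sym (∣∸⇒%≡ pp n₁≤n pp∣n∸n₁))
    ...   | inj₂ pp∣n+n₁ = inj₂ (hit , pp∣n+n₁)
    same-congruent : ∀ {m n} → Same m → Same n → m < n → M ∣ n ∸ m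
    same-congruent {m} {n} (hit-m , m≡n₁) (hit-n , n≡n₁) _ =
      hits-congruent {m = m} {n} p≥5 hit-m hit-n (%≡⇒∣∸ pp {m} {n} (trans m≡n₁ (sym n≡n₁)))
    opposite-congruent : ∀ {m n} → Opposite m → Opposite n → m < n → M ∣ n ∸ m
    opposite-congruent {m} {n} (hit-m , pp∣m+n₁) (hit-n , pp∣n+n₁) _ =
      hits-congruent {m = m} {n} p≥5 hit-m hit-n (subst (pp ∣_) ([m+o]∸[n+o]≡m∸n n m n₁) (∣m∣n⇒∣m∸n pp∣n+n₁ pp∣m+n₁))

  bad36 : ℕ → ℕ
  bad36 n = 𝟙 (¬? (good36? (n % 36)))

  -- Residues r = g ∸ 1 are indexed by g = 1 … 36, since sums start at 1.
  hits : ℕ → ℕ → ℕ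
  hits p n = sumTo (λ a → sumTo (λ g → 𝟙 (good36? (g ∸ 1)) * 𝟙 (hit? p a (g ∸ 1) n)) 36) 3

  sieve : ℕ → ℕ → ℕ
  sieve N n = sumTo (λ p → 𝟙 (prime≥5? p) * hits p n) (suc N)

  1≤hits : ∀ {p a n} → 1 ≤ a → a ≤ 3 → Good36 (n % 36) → p * p ∣ n * n + a → 1 ≤ hits p n
  1≤hits {p} {a} {n} 1≤a a≤3 good pp∣ = begin
    1                                                        ≡⟨ cong₂ _*_ (𝟙-yes (good36? r) good) (𝟙-yes (hit? p a r n) (refl , pp∣)) ⟨
    𝟙 (good36? r) * 𝟙 (hit? p a r n)                         ≤⟨ ≤-sumTo (λ g → 𝟙 (good36? (g ∸ 1)) * 𝟙 (hit? p a (g ∸ 1) n)) (s≤s z≤n) (m%n<n n 36) ⟩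
    sumTo (λ g → 𝟙 (good36? (g ∸ 1)) * 𝟙 (hit? p a (g ∸ 1) n)) 36 ≤⟨ ≤-sumTo (λ a → sumTo (λ g → 𝟙 (good36? (g ∸ 1)) * 𝟙 (hit? p a (g ∸ 1) n)) 36) 1≤a a≤3 ⟩
    hits p n                                                 ∎
    where
    open ≤-Reasoning
    r : ℕ
    r = n % 36

  p*p≤n*n+3⇒p≤1+n : ∀ {p n} → p * p ≤ n * n + 3 → p ≤ suc n
  p*p≤n*n+3⇒p≤1+n {p} {n} pp≤ with p ≤? suc n
  ... | yes p≤1+n = p≤1+n
  ... | no p≰1+n = contradiction pp≤ (<⇒≱ (begin-strict
    n * n + 3                   <⟨ m<m+n (n * n + 3) (m≤n+m 1 (4 * n)) ⟩
    n * n + 3 + (4 * n + 1)     ≡⟨ n*n+3+[4*n+1]≡[2+n]*[2+n] n ⟩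
    suc (suc n) * suc (suc n)   ≤⟨ *-mono-≤ (≰⇒> p≰1+n) (≰⇒> p≰1+n) ⟩
    p * p                       ∎))
    where
    open ≤-Reasoning
    n*n+3+[4*n+1]≡[2+n]*[2+n] : ∀ n → n * n + 3 + (4 * n + 1) ≡ suc (suc n) * suc (suc n)
    n*n+3+[4*n+1]≡[2+n]*[2+n] = solve-∀

  5≤prime-square-divisor : ∀ {p x} → Prime p → p * p ∣ x → NoSmallSquare x → 5 ≤ p
  5≤prime-square-divisor {0} ()
  5≤prime-square-divisor {1} ()
  5≤prime-square-divisor {2} _ pp∣ (4∤ , _) = contradiction pp∣ 4∤
  5≤prime-square-divisor {3} _ pp∣ (_ , 9∤) = contradiction pp∣ 9∤
  5≤prime-square-divisor {4} _ pp∣ (4∤ , _) = contradiction (∣-trans (divides 4 refl) pp∣) 4∤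
  5≤prime-square-divisor {suc (suc (suc (suc (suc _))))} _ _ _ = s≤s (s≤s (s≤s (s≤s (s≤s z≤n))))

  1≤sieve : ∀ {N n p a} → Prime p → p * p ∣ n * n + a → n ≤ N → 1 ≤ a → a ≤ 3 → Good36 (n % 36) → 1 ≤ sieve N n
  1≤sieve {N} {n} {p} {a} p-prime pp∣ n≤N 1≤a a≤3 good = begin
    1                                      ≤⟨ 1≤hits {p} {a} {n} 1≤a a≤3 good pp∣ ⟩
    hits p n                               ≡⟨ +-identityʳ _ ⟨
    1 * hits p n                           ≡⟨ cong (_* hits p n) (𝟙-yes (prime≥5? p) (p-prime , p≥5)) ⟨
    𝟙 (prime≥5? p) * hits p n              ≤⟨ ≤-sumTo (λ p → 𝟙 (prime≥5? p) * hits p n) (≤-trans (s≤s z≤n) p≥5) p≤1+N ⟩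
    sieve N n                              ∎
    where
    open ≤-Reasoning
    p≥5 : 5 ≤ p
    p≥5 = 5≤prime-square-divisor p-prime pp∣ (good36⇒noSmallSquare n good 1≤a a≤3)
    p≤1+N : p ≤ suc N
    p≤1+N = ≤-trans (p*p≤n*n+3⇒p≤1+n (≤-trans (∣⇒≤ {{>-nonZero (≤-trans 1≤a (m≤n+m a (n * n)))}} pp∣) (+-monoʳ-≤ (n * n) a≤3))) (s≤s n≤N)

  n^2+a≡n*n+a : ∀ n a → n ^ 2 + a ≡ n * n + a
  n^2+a≡n*n+a n a = cong (λ k → n * k + a) (*-identityʳ n)

  1≤term⊎non-squarefree : ∀ n → 1 ≤ term n ⊎ ∃[ a ] 1 ≤ a × a ≤ 3 × squarefreeᵇ (n * n + a) ≡ false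
  1≤term⊎non-squarefree n
    with squarefreeᵇ (n ^ 2 + 1) in sqf₁ | squarefreeᵇ (n ^ 2 + 2) in sqf₂ | squarefreeᵇ (n ^ 2 + 3) in sqf₃
  ... | true  | true  | true  = inj₁ ≤-refl
  ... | false | _     | _     = inj₂ (1 , ≤-refl , s≤s z≤n , trans (cong squarefreeᵇ (sym (n^2+a≡n*n+a n 1))) sqf₁)
  ... | true  | false | _     = inj₂ (2 , s≤s z≤n , s≤s (s≤s z≤n) , trans (cong squarefreeᵇ (sym (n^2+a≡n*n+a n 2))) sqf₂)
  ... | true  | true  | false = inj₂ (3 , s≤s z≤n , ≤-refl , trans (cong squarefreeᵇ (sym (n^2+a≡n*n+a n 3))) sqf₃)

  sieve-covers : ∀ {N n} → n ≤ N → 1 ≤ term n + bad36 n + sieve N n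
  sieve-covers {N} {n} n≤N with 1≤term⊎non-squarefree n
  ... | inj₁ 1≤term = ≤-trans 1≤term (≤-trans (m≤m+n _ _) (m≤m+n _ _))
  ... | inj₂ (a , 1≤a , a≤3 , non-sqf) with good36? (n % 36)
  ...   | no _ = ≤-trans (m≤n+m 1 (term n)) (m≤m+n _ _)
  ...   | yes good =
    let p , p-prime , pp∣ = squarefreeᵇ≡false⇒∃p*p∣ _ non-sqf
    in ≤-trans (1≤sieve p-prime pp∣ n≤N 1≤a a≤3 good) (m≤n+m (sieve N n) (term n + 0))

  sumTo-residues≤ : ∀ M .{{_ : NonZero M}} (w : ℕ → ℕ) N →
                    sumTo (λ n → w (n % M)) N ≤ sumTo (λ g → w (g ∸ 1)) M * (N / M + 1)
  sumTo-residues≤ M w N = begin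
    sumTo (λ n → w (n % M)) N
      ≤⟨ sumTo-mono-≤ _ _ N (λ {n} _ _ → w[n%M]≤ n) ⟩
    sumTo (λ n → sumTo (λ g → w (g ∸ 1) * 𝟙 (class? (g ∸ 1) n)) M) N
      ≡⟨ sumTo-comm (λ g n → w (g ∸ 1) * 𝟙 (class? (g ∸ 1) n)) N M ⟩
    sumTo (λ g → sumTo (λ n → w (g ∸ 1) * 𝟙 (class? (g ∸ 1) n)) N) M
      ≡⟨ sumTo-cong _ _ M (λ g → sumTo-*ˡ (w (g ∸ 1)) (λ n → 𝟙 (class? (g ∸ 1) n)) N) ⟩
    sumTo (λ g → w (g ∸ 1) * count (class? (g ∸ 1)) N) M
      ≤⟨ sumTo-mono-≤ _ _ M (λ {g} _ _ → *-monoʳ-≤ (w (g ∸ 1)) (count-congruent M (class? (g ∸ 1)) (λ m≡r n≡r _ → %≡⇒∣∸ M (trans m≡r (sym n≡r))) N)) ⟩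
    sumTo (λ g → w (g ∸ 1) * (N / M + 1)) M
      ≡⟨ sumTo-*ʳ (N / M + 1) (λ g → w (g ∸ 1)) M ⟩
    sumTo (λ g → w (g ∸ 1)) M * (N / M + 1) ∎
    where
    open ≤-Reasoning
    class? : ∀ r → Decidable (λ n → n % M ≡ r)
    class? r n = n % M ≟ r
    w[n%M]≤ : ∀ n → w (n % M) ≤ sumTo (λ g → w (g ∸ 1) * 𝟙 (class? (g ∸ 1) n)) M
    w[n%M]≤ n = ≤-trans (≤-reflexive (trans (sym (*-identityʳ _)) (cong (w (n % M) *_) (sym (𝟙-yes (class? (n % M) n) refl)))))
                        (≤-sumTo (λ g → w (g ∸ 1) * 𝟙 (class? (g ∸ 1) n)) (s≤s z≤n) (m%n<n n M))

  sumTo-bad36≤ : ∀ N → sumTo bad36 N ≤ 22 * (N / 36 + 1)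
  sumTo-bad36≤ = sumTo-residues≤ 36 (λ r → 𝟙 (¬? (good36? r)))

  sieveWeight : ℕ → ℕ
  sieveWeight N = sumTo (λ p → 𝟙 (prime≥5? p) * (⌊N/36p²⌋ N p + 1)) (suc N)

  sumTo-hits≤ : ∀ {p} N → Prime≥5 p → sumTo (hits p) N ≤ 84 * (⌊N/36p²⌋ N p + 1)
  sumTo-hits≤ {p} N p≥5 = begin
    sumTo (hits p) N
      ≡⟨ sumTo-comm (λ a n → sumTo (λ g → G g * H a g n) 36) N 3 ⟩
    sumTo (λ a → sumTo (λ n → sumTo (λ g → G g * H a g n) 36) N) 3
      ≡⟨ sumTo-cong _ _ 3 (λ a → sumTo-comm (λ g n → G g * H a g n) N 36) ⟩
    sumTo (λ a → sumTo (λ g → sumTo (λ n → G g * H a g n) N) 36) 3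
      ≡⟨ sumTo-cong _ _ 3 (λ a → sumTo-cong _ _ 36 (λ g → sumTo-*ˡ (G g) (H a g) N)) ⟩
    sumTo (λ a → sumTo (λ g → G g * count (hit? p a (g ∸ 1)) N) 36) 3
      ≤⟨ sumTo-mono-≤ _ _ 3 (λ 1≤a a≤3 → sumTo-mono-≤ _ _ 36 (λ {g} _ _ → *-monoʳ-≤ (G g) (count-hit (g ∸ 1) N p≥5 1≤a a≤3))) ⟩
    sumTo (λ a → sumTo (λ g → G g * B) 36) 3
      ≡⟨ sumTo-cong _ _ 3 (λ _ → sumTo-*ʳ B G 36) ⟩
    sumTo (λ _ → 14 * B) 3
      ≡⟨ sumTo-const (14 * B) 3 ⟩
    3 * (14 * (2 * (q + 1)))
      ≡⟨ 3*[14*[2*x]]≡84*x (q + 1) ⟩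
    84 * (q + 1) ∎
    where
    open ≤-Reasoning
    q B : ℕ
    q = ⌊N/36p²⌋ N p
    B = 2 * (q + 1)
    G : ℕ → ℕ
    G g = 𝟙 (good36? (g ∸ 1))
    H : ℕ → ℕ → ℕ → ℕ
    H a g n = 𝟙 (hit? p a (g ∸ 1) n)
    3*[14*[2*x]]≡84*x : ∀ x → 3 * (14 * (2 * x)) ≡ 84 * x
    3*[14*[2*x]]≡84*x = solve-∀

  sumTo-sieve≤ : ∀ N → sumTo (sieve N) N ≤ 84 * sieveWeight N
  sumTo-sieve≤ N = begin
    sumTo (sieve N) N
      ≡⟨ sumTo-comm (λ p n → w p * hits p n) N (suc N) ⟩
    sumTo (λ p → sumTo (λ n → w p * hits p n) N) (suc N)
      ≡⟨ sumTo-cong _ _ (suc N) (λ p → sumTo-*ˡ (w p) (hits p) N) ⟩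
    sumTo (λ p → w p * sumTo (hits p) N) (suc N)
      ≤⟨ sumTo-mono-≤ _ _ (suc N) (λ {p} _ _ → weighted p) ⟩
    sumTo (λ p → w p * (84 * (⌊N/36p²⌋ N p + 1))) (suc N)
      ≡⟨ sumTo-cong _ _ (suc N) (λ p → x∙yz≈y∙xz (w p) 84 _) ⟩
    sumTo (λ p → 84 * (w p * (⌊N/36p²⌋ N p + 1))) (suc N)
      ≡⟨ sumTo-*ˡ 84 _ (suc N) ⟩
    84 * sieveWeight N ∎
    where
    open ≤-Reasoning
    w : ℕ → ℕ
    w p = 𝟙 (prime≥5? p)
    weighted : ∀ p → w p * sumTo (hits p) N ≤ w p * (84 * (⌊N/36p²⌋ N p + 1))
    weighted p with prime≥5? p
    ... | yes p≥5 = *-monoʳ-≤ 1 (sumTo-hits≤ N p≥5)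
    ... | no _    = z≤n

  N≤sum-term+bad36+84*sieveWeight : ∀ N → N ≤ sumTo term N + sumTo bad36 N + 84 * sieveWeight N
  N≤sum-term+bad36+84*sieveWeight N = begin
    N                                                       ≡⟨ trans (sumTo-const 1 N) (*-identityʳ N) ⟨
    sumTo (λ _ → 1) N                                       ≤⟨ sumTo-mono-≤ _ _ N (λ _ n≤N → sieve-covers n≤N) ⟩
    sumTo (λ n → term n + bad36 n + sieve N n) N            ≡⟨ sumTo-distrib-+ _ (sieve N) N ⟩
    sumTo (λ n → term n + bad36 n) N + sumTo (sieve N) N     ≡⟨ cong (_+ sumTo (sieve N) N) (sumTo-distrib-+ term bad36 N) ⟩
    sumTo term N + sumTo bad36 N + sumTo (sieve N) N         ≤⟨ +-monoʳ-≤ (sumTo term N + sumTo bad36 N) (sumTo-sieve≤ N) ⟩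
    sumTo term N + sumTo bad36 N + 84 * sieveWeight N        ∎
    where open ≤-Reasoning


module Primes where

  open import Data.Nat
  open import Data.Nat.Properties
  open import Data.Nat.Combinatorics
  open import Data.Nat.Divisibility
  open import Data.Nat.DivMod using (m/n*n≡m)
  open import Data.Nat.Induction using (<-rec)
  open import Data.Nat.Primality
  open import Data.Nat.Tactic.RingSolver using (solve-∀)
  open import Data.Product using (∃-syntax; _×_; _,_)
  open import Data.Sum using (_⊎_; inj₁; inj₂)
  open import Relation.Binary.PropositionalEquality
  open import Relation.Nullary using (yes; no; ¬_; contradiction)
  open import Relation.Nullary.Decidable using (_×-dec_)
  open import Relation.Unary using (Decidable)
  open Sums
  open PrimeSquares

  nCk≤2^n : ∀ n k → n C k ≤ 2 ^ n
  nCk≤2^n n       zero    = ≤-trans (≤-reflexive (trans (nCk≡nC[n∸k] {n = n} z≤n) (nCn≡1 n))) (m^n>0 2 n)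
  nCk≤2^n zero    (suc k) = ≤-trans (≤-reflexive (k>n⇒nCk≡0 {0} {suc k} (s≤s z≤n))) z≤n
  nCk≤2^n (suc n) (suc k) = begin
    suc n C suc k       ≡⟨ nCk+nC[k+1]≡[n+1]C[k+1] n k ⟨
    n C k + n C suc k   ≤⟨ +-mono-≤ (nCk≤2^n n k) (nCk≤2^n n (suc k)) ⟩
    2 ^ n + 2 ^ n       ≡⟨ cong (2 ^ n +_) (+-identityʳ (2 ^ n)) ⟨
    2 ^ suc n           ∎
    where open ≤-Reasoning

  prime∣n!⇒≤ : ∀ {p} n → Prime p → p ∣ n ! → p ≤ n
  prime∣n!⇒≤ zero    p-prime p∣1 = contradiction (∣⇒≤ p∣1) (<⇒≱ (prime⇒2≤ p-prime))
  prime∣n!⇒≤ (suc n) p-prime p∣n! with euclidsLemma (suc n) (n !) p-prime p∣n!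
  ... | inj₁ p∣1+n = ∣⇒≤ p∣1+n
  ... | inj₂ p∣n!  = m≤n⇒m≤1+n (prime∣n!⇒≤ n p-prime p∣n!)

  nCk*[k!*[n∸k]!]≡n! : ∀ {n k} → k ≤ n → (n C k) * (k ! * (n ∸ k) !) ≡ n !
  nCk*[k!*[n∸k]!]≡n! {n} {k} k≤n =
    trans (cong (_* (k ! * (n ∸ k) !)) (nCk≡n!/k![n-k]! k≤n)) (m/n*n≡m {{k !* (n ∸ k) !≢0}} (k![n∸k]!∣n! k≤n))

  nCk≢0 : ∀ {n k} → k ≤ n → NonZero (n C k)
  nCk≢0 {n} {k} k≤n = ≢-nonZero λ nCk≡0 →
    ≢-nonZero⁻¹ (n !) {{n !≢0}} (trans (sym (nCk*[k!*[n∸k]!]≡n! k≤n)) (cong (_* (k ! * (n ∸ k) !)) nCk≡0))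

  n∣n! : ∀ {n} → NonZero n → n ∣ n !
  n∣n! {suc n} _ = divides (n !) (*-comm (suc n) (n !))

  -- p ∣ (2m+1)! but p is larger than m and m + 1, so p ∤ m! (m+1)!.
  prime∣[1+m+m]Cm : ∀ {p} m → Prime p → suc m < p → p ≤ suc m + m → p ∣ (suc m + m) C m
  prime∣[1+m+m]Cm {p} m p-prime m+1<p p≤2m+1
    with euclidsLemma ((suc m + m) C m) (m ! * (suc m + m ∸ m) !) p-prime
           (subst (p ∣_) (sym (nCk*[k!*[n∸k]!]≡n! (m≤n+m m (suc m)))) (∣-trans (n∣n! (prime⇒nonZero p-prime)) (m≤n⇒m!∣n! p≤2m+1)))
  ... | inj₁ p∣C = p∣C
  ... | inj₂ p∣m!*[m+1]! with euclidsLemma (m !) ((suc m + m ∸ m) !) p-prime p∣m!*[m+1]!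
  ...   | inj₁ p∣m!    = contradiction (prime∣n!⇒≤ m p-prime p∣m!) (<⇒≱ (<-trans (n<1+n m) m+1<p))
  ...   | inj₂ p∣[m+1]! = contradiction (prime∣n!⇒≤ _ p-prime p∣[m+1]!) (<⇒≱ (subst (_< p) (sym (m+n∸n≡m (suc m) m)) m+1<p))

  productTo : (ℕ → ℕ) → ℕ → ℕ
  productTo f zero    = 1
  productTo f (suc N) = productTo f N * f (suc N)

  BigPrime : ℕ → ℕ → Set
  BigPrime k x = Prime x × 2 ^ k < x

  bigPrime? : ∀ k → Decidable (BigPrime k)
  bigPrime? k x = prime? x ×-dec 2 ^ k <? x

  -- The product of the primes p ∈ (m + 1, 2m + 1] with p > 2ᵏ divides (2m+1 choose m) ≤ 2^(2m+1).
  module _ (k m : ℕ) where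

    private
      big : ℕ → ℕ
      big i = 𝟙 (bigPrime? k (suc m + i))

      factor : ℕ → ℕ
      factor i = (suc m + i) ^ big i

      2^[k*big]≤factor : ∀ i → 2 ^ (k * big i) ≤ factor i
      2^[k*big]≤factor i with bigPrime? k (suc m + i)
      ... | yes (_ , 2^k<x) = ≤-trans (≤-reflexive (cong (2 ^_) (*-identityʳ k)))
                                      (≤-trans (<⇒≤ 2^k<x) (≤-reflexive (sym (*-identityʳ _))))
      ... | no _            = ≤-reflexive (cong (2 ^_) (*-zeroʳ k))

      2^[k*count]≤product : ∀ j → 2 ^ (k * sumTo big j) ≤ productTo factor j
      2^[k*count]≤product zero    = ≤-reflexive (cong (2 ^_) (*-zeroʳ k))
      2^[k*count]≤product (suc j) = begin
        2 ^ (k * (sumTo big j + big (suc j)))          ≡⟨ cong (2 ^_) (*-distribˡ-+ k (sumTo big j) (big (suc j))) ⟩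
        2 ^ (k * sumTo big j + k * big (suc j))        ≡⟨ ^-distribˡ-+-* 2 (k * sumTo big j) (k * big (suc j)) ⟩
        2 ^ (k * sumTo big j) * 2 ^ (k * big (suc j))  ≤⟨ *-mono-≤ (2^[k*count]≤product j) (2^[k*big]≤factor (suc j)) ⟩
        productTo factor j * factor (suc j)            ∎
        where open ≤-Reasoning

      prime∤factor : ∀ {p} i → Prime p → suc m + i < p → p ∤ factor i
      prime∤factor {p} i p-prime x<p p∣factor with bigPrime? k (suc m + i)
      ... | yes _ = <⇒≱ x<p (∣⇒≤ (subst (p ∣_) (*-identityʳ (suc m + i)) p∣factor))
      ... | no _  = <⇒≱ (prime⇒2≤ p-prime) (∣⇒≤ p∣factor)

      prime∤product : ∀ {p} j → Prime p → suc m + j < p → p ∤ productTo factor j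
      prime∤product zero    p-prime _   p∣1 = <⇒≱ (prime⇒2≤ p-prime) (∣⇒≤ p∣1)
      prime∤product (suc j) p-prime x<p p∣product with euclidsLemma _ _ p-prime p∣product
      ... | inj₁ p∣product = prime∤product j p-prime (≤-trans (s≤s (+-monoʳ-≤ (suc m) (n≤1+n j))) x<p) p∣product
      ... | inj₂ p∣factor  = prime∤factor (suc j) p-prime x<p p∣factor

      product∣C : ∀ j → j ≤ m → productTo factor j ∣ (suc m + m) C m
      product∣C zero    _   = 1∣ _
      product∣C (suc j) j<m with product∣C j (≤-trans (n≤1+n j) j<m) | bigPrime? k (suc m + suc j)
      ... | product∣C | no _ = subst (_∣ (suc m + m) C m) (sym (*-identityʳ _)) product∣C
      ... | divides q C≡q*product | yes (p-prime , _) =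
        subst (_∣ (suc m + m) C m) (cong (productTo factor j *_) (sym (*-identityʳ p)))
              (subst (productTo factor j * p ∣_) (trans (*-comm (productTo factor j) q) (sym C≡q*product))
                     (*-monoʳ-∣ (productTo factor j) p∣q))
        where
        p : ℕ
        p = suc m + suc j
        p∣C : p ∣ (suc m + m) C m
        p∣C = prime∣[1+m+m]Cm m p-prime (s≤s (subst (suc m ≤_) (sym (+-suc m j)) (s≤s (m≤m+n m j)))) (+-monoʳ-≤ (suc m) j<m)
        p∣q : p ∣ q
        p∣q with euclidsLemma q (productTo factor j) p-prime (subst (p ∣_) C≡q*product p∣C)
        ... | inj₁ p∣q       = p∣q
        ... | inj₂ p∣product = contradiction p∣product (prime∤product j p-prime (s≤s (≤-reflexive (sym (+-suc m j)))))

    k*count-bigPrime-block≤ : k * count (λ i → bigPrime? k (suc m + i)) m ≤ suc m + m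
    k*count-bigPrime-block≤ with k * sumTo big m ≤? suc m + m
    ... | yes bound = bound
    ... | no ¬bound = contradiction 2^[k*count]≤2^[1+m+m] (<⇒≱ (^-monoʳ-< 2 (s≤s (s≤s z≤n)) (≰⇒> ¬bound)))
      where
      2^[k*count]≤2^[1+m+m] : 2 ^ (k * sumTo big m) ≤ 2 ^ (suc m + m)
      2^[k*count]≤2^[1+m+m] = ≤-trans (2^[k*count]≤product m)
        (≤-trans (∣⇒≤ {{nCk≢0 (m≤n+m m (suc m))}} (product∣C m ≤-refl)) (nCk≤2^n (suc m + m) m))

  even⊎odd : ∀ n → ∃[ m ] (n ≡ m + m ⊎ n ≡ suc (m + m))
  even⊎odd zero    = 0 , inj₁ refl
  even⊎odd (suc n) with even⊎odd n
  ... | m , inj₁ n≡m+m   = m , inj₂ (cong suc n≡m+m)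
  ... | m , inj₂ n≡1+m+m = suc m , inj₁ (cong suc (trans n≡1+m+m (sym (+-suc m m))))

  k*count-bigPrime≤4*X : ∀ {k} → 1 ≤ k → ∀ X → k * count (bigPrime? k) X ≤ 4 * X
  k*count-bigPrime≤4*X {k} 1≤k = <-rec _ bound
    where
    bound : ∀ X → (∀ {Y} → Y < X → k * count (bigPrime? k) Y ≤ 4 * Y) → k * count (bigPrime? k) X ≤ 4 * X
    bound X rec with even⊎odd X
    ... | zero , inj₁ refl = ≤-reflexive (*-zeroʳ k)
    ... | zero , inj₂ refl = ≤-trans (≤-reflexive (trans (cong (k *_) (𝟙-no (bigPrime? k 1) λ (1-prime , _) → ¬prime[1] 1-prime)) (*-zeroʳ k))) z≤n
    ... | suc m , inj₁ refl = begin
      k * (count (bigPrime? k) (m + suc m) + 𝟙 (bigPrime? k (suc m + suc m)))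
        ≡⟨ cong (λ c → k * (count (bigPrime? k) (m + suc m) + c)) (𝟙-no (bigPrime? k (suc m + suc m)) not-big) ⟩
      k * (count (bigPrime? k) (m + suc m) + 0)
        ≡⟨ cong (k *_) (+-identityʳ _) ⟩
      k * count (bigPrime? k) (m + suc m)
        ≤⟨ rec ≤-refl ⟩
      4 * (m + suc m)
        ≤⟨ *-monoʳ-≤ 4 (n≤1+n _) ⟩
      4 * (suc m + suc m) ∎
      where
      open ≤-Reasoning
      not-big : ¬ BigPrime k (suc m + suc m)
      not-big (p-prime , 2^k<p) with prime⇒irreducible p-prime (divides (suc m) (trans (cong (suc m +_) (sym (+-identityʳ (suc m)))) (*-comm 2 (suc m))))
      ... | inj₂ 2≡p = <⇒≱ (subst (2 ^ k <_) (sym 2≡p) 2^k<p) (^-monoʳ-≤ 2 1≤k)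
    ... | suc m , inj₂ refl = begin
      k * count (bigPrime? k) (suc (suc m) + suc m)
        ≡⟨ cong (k *_) (sumTo-split _ (suc (suc m)) (suc m)) ⟩
      k * (count (bigPrime? k) (suc (suc m)) + count (λ i → bigPrime? k (suc (suc m) + i)) (suc m))
        ≡⟨ *-distribˡ-+ k _ _ ⟩
      k * count (bigPrime? k) (suc (suc m)) + k * count (λ i → bigPrime? k (suc (suc m) + i)) (suc m)
        ≤⟨ +-mono-≤ (rec (s≤s (s≤s (m≤n+m (suc m) m)))) (k*count-bigPrime-block≤ k (suc m)) ⟩
      4 * suc (suc m) + (suc (suc m) + suc m)
        ≤⟨ m≤m+n _ (2 * m + 1) ⟩
      4 * suc (suc m) + (suc (suc m) + suc m) + (2 * m + 1)
        ≡⟨ 4*[2+m]+[2+m+[1+m]]+[2*m+1]≡4*[2+m+[1+m]] m ⟩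
      4 * (suc (suc m) + suc m) ∎
      where
      open ≤-Reasoning
      4*[2+m]+[2+m+[1+m]]+[2*m+1]≡4*[2+m+[1+m]] : ∀ m → 4 * suc (suc m) + (suc (suc m) + suc m) + (2 * m + 1) ≡ 4 * (suc (suc m) + suc m)
      4*[2+m]+[2+m+[1+m]]+[2*m+1]≡4*[2+m+[1+m]] = solve-∀


module Arithmetic where

  open import Data.Nat
  open import Data.Nat.Properties
  open import Data.Nat.Tactic.RingSolver using (solve-∀)
  open import Relation.Binary.PropositionalEquality

  -- Every bound is scaled by 9·10⁶ = 250 · 36000 before it is added up.
  module DensityArithmetic {N S A T T₁ T₂ T₃ J Q K : ℕ}
    (N≤S+A+84T : N ≤ S + A + 84 * T) (A≤ : A ≤ 22 * (J + 1)) (36J≤N : 36 * J ≤ N)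
    (T≤ : T ≤ T₁ + T₂ + T₃) (T₁≤ : 1000000 * T₁ ≤ 90679 * J) (T₂≤ : 300 * T₂ ≤ J)
    (T₃≤ : T₃ ≤ Q + K) (Q≤ : 40000 * Q ≤ 4 * suc N) where

    open ≤-Reasoning

    private
      36J-scaled : ∀ c → c * 36 * J ≤ c * N
      36J-scaled c = ≤-trans (≤-reflexive (*-assoc c 36 J)) (*-monoʳ-≤ c 36J≤N)

      A-scaled : 9000000 * A ≤ 5500000 * N + 198000000
      A-scaled = begin
        9000000 * A                          ≤⟨ *-monoʳ-≤ 9000000 A≤ ⟩
        9000000 * (22 * (J + 1))             ≡⟨ c*[d*[x+1]]≡c*d*x+c*d 9000000 22 J ⟩
        5500000 * 36 * J + 198000000         ≤⟨ +-monoˡ-≤ 198000000 (36J-scaled 5500000) ⟩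
        5500000 * N + 198000000              ∎
        where
        c*[d*[x+1]]≡c*d*x+c*d : ∀ c d x → c * (d * (x + 1)) ≡ c * d * x + c * d
        c*[d*[x+1]]≡c*d*x+c*d = solve-∀

      T₁-scaled : 756000000 * T₁ ≤ 1904259 * N
      T₁-scaled = begin
        756000000 * T₁          ≡⟨ *-assoc 756 1000000 T₁ ⟩
        756 * (1000000 * T₁)    ≤⟨ *-monoʳ-≤ 756 T₁≤ ⟩
        756 * (90679 * J)       ≡⟨ *-assoc 756 90679 J ⟨
        1904259 * 36 * J        ≤⟨ 36J-scaled 1904259 ⟩
        1904259 * N             ∎

      T₂-scaled : 756000000 * T₂ ≤ 70000 * N
      T₂-scaled = begin
        756000000 * T₂          ≡⟨ *-assoc 2520000 300 T₂ ⟩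
        2520000 * (300 * T₂)    ≤⟨ *-monoʳ-≤ 2520000 T₂≤ ⟩
        70000 * 36 * J          ≤⟨ 36J-scaled 70000 ⟩
        70000 * N               ∎

      T₃-scaled : 756000000 * T₃ ≤ 756000000 * K + (75600 * N + 75600)
      T₃-scaled = begin
        756000000 * T₃                           ≤⟨ *-monoʳ-≤ 756000000 (≤-trans T₃≤ (≤-reflexive (+-comm Q K))) ⟩
        756000000 * (K + Q)                      ≡⟨ *-distribˡ-+ 756000000 K Q ⟩
        756000000 * K + 18900 * 40000 * Q        ≡⟨ cong (756000000 * K +_) (*-assoc 18900 40000 Q) ⟩
        756000000 * K + 18900 * (40000 * Q)      ≤⟨ +-monoʳ-≤ (756000000 * K) (*-monoʳ-≤ 18900 Q≤) ⟩
        756000000 * K + 18900 * (4 * suc N)      ≡⟨ cong (756000000 * K +_) (c*[d*[1+x]]≡c*d*x+c*d 18900 4 N) ⟩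
        756000000 * K + (75600 * N + 75600)      ∎
        where
        c*[d*[1+x]]≡c*d*x+c*d : ∀ c d x → c * (d * suc x) ≡ c * d * x + c * d
        c*[d*[1+x]]≡c*d*x+c*d = solve-∀

      84T-scaled : 9000000 * (84 * T) ≤ 2049859 * N + (756000000 * K + 75600)
      84T-scaled = begin
        9000000 * (84 * T)                                      ≡⟨ *-assoc 9000000 84 T ⟨
        756000000 * T                                           ≤⟨ *-monoʳ-≤ 756000000 T≤ ⟩
        756000000 * (T₁ + T₂ + T₃)                              ≡⟨ c*[x+y+z]≡c*x+c*y+c*z 756000000 T₁ T₂ T₃ ⟩
        756000000 * T₁ + 756000000 * T₂ + 756000000 * T₃        ≤⟨ +-mono-≤ (+-mono-≤ T₁-scaled T₂-scaled) T₃-scaled ⟩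
        1904259 * N + 70000 * N + (756000000 * K + (75600 * N + 75600)) ≡⟨ collect 1904259 70000 756000000 75600 75600 N K ⟩
        (1904259 + 70000 + 75600) * N + (756000000 * K + 75600) ∎
        where
        c*[x+y+z]≡c*x+c*y+c*z : ∀ c x y z → c * (x + y + z) ≡ c * x + c * y + c * z
        c*[x+y+z]≡c*x+c*y+c*z = solve-∀
        collect : ∀ a b c d e N K → a * N + b * N + (c * K + (d * N + e)) ≡ (a + b + d) * N + (c * K + e)
        collect = solve-∀

    error : ℕ
    error = 7549859 * N + (756000000 * K + 198075600)

    9000000N≤9000000S+error : 9000000 * N ≤ 9000000 * S + error
    9000000N≤9000000S+error = begin
      9000000 * N                                                     ≤⟨ *-monoʳ-≤ 9000000 N≤S+A+84T ⟩
      9000000 * (S + A + 84 * T)                                      ≡⟨ *-distribˡ-+ 9000000 (S + A) (84 * T) ⟩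
      9000000 * (S + A) + 9000000 * (84 * T)                          ≡⟨ cong (_+ 9000000 * (84 * T)) (*-distribˡ-+ 9000000 S A) ⟩
      9000000 * S + 9000000 * A + 9000000 * (84 * T)                  ≤⟨ +-mono-≤ (+-monoʳ-≤ (9000000 * S) A-scaled) 84T-scaled ⟩
      9000000 * S + (5500000 * N + 198000000) + (2049859 * N + (756000000 * K + 75600)) ≡⟨ collect (9000000 * S) 5500000 198000000 2049859 756000000 75600 N K ⟩
      9000000 * S + ((5500000 + 2049859) * N + (756000000 * K + (198000000 + 75600))) ∎
      where
      collect : ∀ s a b c d e N K → s + (a * N + b) + (c * N + (d * K + e)) ≡ s + ((a + c) * N + (d * K + (b + e)))
      collect = solve-∀

    37[1+N]≤250S : 6400 * (K + 1) ≤ N → 37 * suc N ≤ 250 * S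
    37[1+N]≤250S N≥N₀ = *-cancelˡ-≤ 36000 (+-cancelʳ-≤ error _ _ (begin
      36000 * (37 * suc N) + error
        ≡⟨ cong (_+ error) (*-assoc 36000 37 (suc N)) ⟨
      1332000 * suc N + error
        ≡⟨ expand 1332000 7549859 756000000 198075600 N K ⟩
      8881859 * N + (756000000 * K + 199407600)
        ≤⟨ +-monoʳ-≤ (8881859 * N) (+-mono-≤ (*-monoˡ-≤ K (m≤m+n 756000000 102400)) (m≤m+n 199407600 556694800)) ⟩
      8881859 * N + (756102400 * K + 756102400)
        ≡⟨ cong (8881859 * N +_) (c*[x+1]≡c*x+c 756102400 K) ⟩
      8881859 * N + 118141 * 6400 * (K + 1)
        ≤⟨ +-monoʳ-≤ (8881859 * N) (≤-trans (≤-reflexive (*-assoc 118141 6400 (K + 1))) (*-monoʳ-≤ 118141 N≥N₀)) ⟩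
      8881859 * N + 118141 * N
        ≡⟨ *-distribʳ-+ N 8881859 118141 ⟨
      9000000 * N
        ≤⟨ 9000000N≤9000000S+error ⟩
      9000000 * S + error
        ≡⟨ cong (_+ error) (*-assoc 36000 250 S) ⟩
      36000 * (250 * S) + error ∎))
      where
      expand : ∀ a b c d N K → a * suc N + (b * N + (c * K + d)) ≡ (a + b) * N + (c * K + (a + d))
      expand = solve-∀
      c*[x+1]≡c*x+c : ∀ c x → c * x + c ≡ c * (x + 1)
      c*[x+1]≡c*x+c = solve-∀


module SieveWeight where

  open import Data.Nat
  open import Data.Nat.Properties
  open import Data.Nat.DivMod
  open import Data.Nat.Primality using (Prime; prime?)
  open import Data.Product using (_,_; proj₁)
  open import Data.Sum using (_⊎_; inj₁; inj₂)
  open import Relation.Binary.PropositionalEquality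
  open import Relation.Nullary using (yes; no)
  open import Algebra.Properties.CommutativeSemigroup *-commutativeSemigroup using (x∙yz≈y∙xz)
  open Sums
  open Sieve
  open Primes

  -- Opaque, so that the typechecker never unfolds the division on open arguments.
  opaque
    ⌈_/_⌉ : (c d : ℕ) .{{_ : NonZero d}} → ℕ
    ⌈ c / d ⌉ = (c + d ∸ 1) / d

    c≤⌈c/d⌉*d : ∀ c d .{{_ : NonZero d}} → c ≤ ⌈ c / d ⌉ * d
    c≤⌈c/d⌉*d c d@(suc d-1) = +-cancelʳ-≤ d-1 c _ (begin
      c + d-1                   ≡⟨ +-∸-assoc c {d} {1} (s≤s z≤n) ⟨
      c + d ∸ 1                 ≡⟨ m≡m%n+[m/n]*n (c + d ∸ 1) d ⟩
      (c + d ∸ 1) % d + q * d   ≤⟨ +-monoˡ-≤ (q * d) (≤-pred (m%n<n (c + d ∸ 1) d)) ⟩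
      d-1 + q * d               ≡⟨ +-comm d-1 (q * d) ⟩
      q * d + d-1               ∎)
      where
      open ≤-Reasoning
      q : ℕ
      q = ⌈ c / d ⌉

  c*[x/d]≤⌈c/d⌉*x : ∀ c x d .{{_ : NonZero d}} → c * (x / d) ≤ ⌈ c / d ⌉ * x
  c*[x/d]≤⌈c/d⌉*x c x d = begin
    c * (x / d)                  ≤⟨ *-monoˡ-≤ (x / d) (c≤⌈c/d⌉*d c d) ⟩
    ⌈ c / d ⌉ * d * (x / d)      ≡⟨ *-assoc ⌈ c / d ⌉ d (x / d) ⟩
    ⌈ c / d ⌉ * (d * (x / d))    ≤⟨ *-monoʳ-≤ ⌈ c / d ⌉ (≤-trans (≤-reflexive (*-comm d (x / d))) (m/n*n≤m x d)) ⟩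
    ⌈ c / d ⌉ * x                ∎
    where open ≤-Reasoning

  ⌈10⁶/p²⌉ : ℕ → ℕ
  ⌈10⁶/p²⌉ zero        = 0
  ⌈10⁶/p²⌉ p@(suc _)   = ⌈ 1000000 / p * p ⌉

  ⌊N/36p²⌋≡ : ∀ N p → ⌊N/36p²⌋ N (suc p) ≡ (N / 36) / (suc p * suc p)
  ⌊N/36p²⌋≡ N p = sym (m/n/o≡m/[n*o] N 36 (suc p * suc p))

  opaque
    unfolding ⌈_/_⌉

    sum-⌈10⁶/p²⌉ : sumTo (λ p → 𝟙 (prime≥5? p) * ⌈10⁶/p²⌉ p) 300 ≡ 90679
    sum-⌈10⁶/p²⌉ = refl

  sumTo-weighted≤ : ∀ D (w c q : ℕ → ℕ) J L → (∀ p → D * q p ≤ c p * J) →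
                    D * sumTo (λ p → w p * q p) L ≤ sumTo (λ p → w p * c p) L * J
  sumTo-weighted≤ D w c q J L D*q≤c*J = begin
    D * sumTo (λ p → w p * q p) L      ≡⟨ sumTo-*ˡ D _ L ⟨
    sumTo (λ p → D * (w p * q p)) L    ≤⟨ sumTo-mono-≤ _ _ L (λ {p} _ _ → scaled p) ⟩
    sumTo (λ p → w p * c p * J) L      ≡⟨ sumTo-*ʳ J (λ p → w p * c p) L ⟩
    sumTo (λ p → w p * c p) L * J      ∎
    where
    open ≤-Reasoning
    scaled : ∀ p → D * (w p * q p) ≤ w p * c p * J
    scaled p = begin
      D * (w p * q p)   ≡⟨ x∙yz≈y∙xz D (w p) (q p) ⟩
      w p * (D * q p)   ≤⟨ *-monoʳ-≤ (w p) (D*q≤c*J p) ⟩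
      w p * (c p * J)   ≡⟨ *-assoc (w p) (c p) J ⟨
      w p * c p * J     ∎

  small-primes≤ : ∀ N → 1000000 * sumTo (λ p → 𝟙 (prime≥5? p) * ⌊N/36p²⌋ N p) 300 ≤ 90679 * (N / 36)
  small-primes≤ N = ≤-trans
    (sumTo-weighted≤ 1000000 (λ p → 𝟙 (prime≥5? p)) ⌈10⁶/p²⌉ (⌊N/36p²⌋ N) (N / 36) 300 scaled)
    (≤-reflexive (cong (_* (N / 36)) sum-⌈10⁶/p²⌉))
    where
    scaled : ∀ p → 1000000 * ⌊N/36p²⌋ N p ≤ ⌈10⁶/p²⌉ p * (N / 36)
    scaled zero    = z≤n
    scaled (suc p) = begin
      1000000 * ⌊N/36p²⌋ N (suc p)             ≡⟨ cong (1000000 *_) (⌊N/36p²⌋≡ N p) ⟩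
      1000000 * ((N / 36) / (suc p * suc p))   ≤⟨ c*[x/d]≤⌈c/d⌉*x 1000000 (N / 36) (suc p * suc p) ⟩
      ⌈10⁶/p²⌉ (suc p) * (N / 36)              ∎
      where open ≤-Reasoning

  J/[m+1]²+J/[m+1]≤J/m : ∀ J m → J / (suc (suc m) * suc (suc m)) + J / suc (suc m) ≤ J / suc m
  J/[m+1]²+J/[m+1]≤J/m J m = *≤⇒≤/ (begin
    (q + r) * suc m             ≡⟨ *-distribʳ-+ (suc m) q r ⟩
    q * suc m + r * suc m       ≤⟨ +-monoˡ-≤ (r * suc m) (≤-trans (*-monoʳ-≤ q (n≤1+n (suc m))) q*a≤r) ⟩
    r + r * suc m               ≡⟨ *-suc r (suc m) ⟨
    r * a                       ≤⟨ m/n*n≤m J a ⟩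
    J                           ∎)
    where
    open ≤-Reasoning
    a q r : ℕ
    a = suc (suc m)
    q = J / (a * a)
    r = J / a
    *≤⇒≤/ : ∀ {x y d} .{{_ : NonZero d}} → x * d ≤ y → x ≤ y / d
    *≤⇒≤/ {x} {y} {d} x*d≤y = ≤-trans (≤-reflexive (sym (m*n/n≡m x d))) (/-monoˡ-≤ d x*d≤y)
    q*a≤r : q * a ≤ r
    q*a≤r = *≤⇒≤/ (≤-trans (≤-reflexive (trans (*-assoc q a a) (*-comm q (a * a)))) (≤-trans (≤-reflexive (*-comm (a * a) q)) (m/n*n≤m J (a * a))))

  sumTo-J/m²≤J/L : ∀ J L k → sumTo (λ i → J / ((suc L + i) * (suc L + i))) k + J / (suc L + k) ≤ J / suc L
  sumTo-J/m²≤J/L J L zero    = ≤-reflexive (cong (λ m → J / suc m) (+-identityʳ L))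
  sumTo-J/m²≤J/L J L (suc k) = begin
    S + J / (m′ * m′) + J / m′         ≡⟨ +-assoc S _ _ ⟩
    S + (J / (m′ * m′) + J / m′)       ≡⟨ cong (λ m → S + (J / (suc m * suc m) + J / suc m)) (+-suc L k) ⟩
    S + (J / (suc m * suc m) + J / suc m) ≤⟨ +-monoʳ-≤ S (J/[m+1]²+J/[m+1]≤J/m J (L + k)) ⟩
    S + J / (suc L + k)                ≤⟨ sumTo-J/m²≤J/L J L k ⟩
    J / suc L                          ∎
    where
    open ≤-Reasoning
    S m′ m : ℕ
    S = sumTo (λ i → J / ((suc L + i) * (suc L + i))) k
    m′ = suc L + suc k
    m = suc L + k

  large-primes≤ : ∀ N L k → sumTo (λ i → ⌊N/36p²⌋ N (suc L + i)) k ≤ (N / 36) / suc L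
  large-primes≤ N L k = begin
    sumTo (λ i → ⌊N/36p²⌋ N (suc L + i)) k                                    ≡⟨ sumTo-cong _ _ k (λ i → ⌊N/36p²⌋≡ N (L + i)) ⟩
    sumTo (λ i → (N / 36) / ((suc L + i) * (suc L + i))) k                    ≤⟨ m≤m+n _ _ ⟩
    sumTo (λ i → (N / 36) / ((suc L + i) * (suc L + i))) k + (N / 36) / (suc L + k) ≤⟨ sumTo-J/m²≤J/L (N / 36) L k ⟩
    (N / 36) / suc L                                                          ∎
    where open ≤-Reasoning

  300*large-primes≤N/36 : ∀ N k → 300 * sumTo (λ i → ⌊N/36p²⌋ N (300 + i)) k ≤ N / 36
  300*large-primes≤N/36 N k = ≤-trans (*-monoʳ-≤ 300 (large-primes≤ N 299 k))
                                     (≤-trans (≤-reflexive (*-comm 300 ((N / 36) / 300))) (m/n*n≤m (N / 36) 300))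

  count-≤K≤K : ∀ K X → count (λ x → x ≤? K) X ≤ K
  count-≤K≤K K X with ≤-total X K
  ... | inj₁ X≤K = ≤-trans (count≤length _ X) X≤K
  ... | inj₂ K≤X = begin
    count (λ x → x ≤? K) X                       ≡⟨ cong (count (λ x → x ≤? K)) (m+[n∸m]≡n K≤X) ⟨
    count (λ x → x ≤? K) (K + (X ∸ K))           ≡⟨ sumTo-split _ K (X ∸ K) ⟩
    count (λ x → x ≤? K) K + count (λ i → K + i ≤? K) (X ∸ K) ≡⟨ cong (count (λ x → x ≤? K) K +_) (sumTo-≡0 _ (X ∸ K) (λ 1≤i _ → 𝟙-no (_ ≤? K) (λ K+i≤K → <⇒≱ (m<m+n K 1≤i) K+i≤K))) ⟩
    count (λ x → x ≤? K) K + 0                   ≤⟨ ≤-reflexive (+-identityʳ _) ⟩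
    count (λ x → x ≤? K) K                       ≤⟨ count≤length _ K ⟩
    K                                            ∎
    where open ≤-Reasoning

  count-prime≤ : ∀ κ X → count prime? X ≤ count (bigPrime? κ) X + 2 ^ κ
  count-prime≤ κ X = begin
    count prime? X                                                  ≤⟨ sumTo-mono-≤ _ _ X (λ {x} _ _ → 𝟙-⊎ (prime? x) (x ≤? 2 ^ κ) (bigPrime? κ x) small⊎big) ⟩
    sumTo (λ x → 𝟙 (x ≤? 2 ^ κ) + 𝟙 (bigPrime? κ x)) X               ≡⟨ sumTo-distrib-+ _ _ X ⟩
    count (λ x → x ≤? 2 ^ κ) X + count (bigPrime? κ) X               ≤⟨ +-monoˡ-≤ _ (count-≤K≤K (2 ^ κ) X) ⟩
    2 ^ κ + count (bigPrime? κ) X                                   ≡⟨ +-comm (2 ^ κ) _ ⟩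
    count (bigPrime? κ) X + 2 ^ κ                                   ∎
    where
    open ≤-Reasoning
    small⊎big : ∀ {x} → Prime x → x ≤ 2 ^ κ ⊎ BigPrime κ x
    small⊎big {x} x-prime with x ≤? 2 ^ κ
    ... | yes x≤2^κ = inj₁ x≤2^κ
    ... | no  x≰2^κ = inj₂ (x-prime , ≰⇒> x≰2^κ)

  sieveWeight≤ : ∀ N L k → suc N ≡ L + k →
    sieveWeight N ≤ sumTo (λ p → 𝟙 (prime≥5? p) * ⌊N/36p²⌋ N p) L + sumTo (λ i → ⌊N/36p²⌋ N (L + i)) k + count prime? (suc N)
  sieveWeight≤ N L k 1+N≡L+k = begin
    sieveWeight N
      ≡⟨ sumTo-cong _ _ (suc N) (λ p → trans (*-distribˡ-+ (w p) (q p) 1) (cong (w p * q p +_) (*-identityʳ (w p)))) ⟩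
    sumTo (λ p → w p * q p + w p) (suc N)
      ≡⟨ sumTo-distrib-+ _ _ (suc N) ⟩
    sumTo (λ p → w p * q p) (suc N) + sumTo w (suc N)
      ≡⟨ cong (λ M → sumTo (λ p → w p * q p) M + sumTo w (suc N)) 1+N≡L+k ⟩
    sumTo (λ p → w p * q p) (L + k) + sumTo w (suc N)
      ≡⟨ cong (_+ sumTo w (suc N)) (sumTo-split _ L k) ⟩
    sumTo (λ p → w p * q p) L + sumTo (λ i → w (L + i) * q (L + i)) k + sumTo w (suc N)
      ≤⟨ +-mono-≤ (+-monoʳ-≤ (sumTo (λ p → w p * q p) L) (sumTo-mono-≤ _ _ k (λ {i} _ _ → *-monoˡ-≤ (q (L + i)) (𝟙≤1 (prime≥5? (L + i))))))
                  (sumTo-mono-≤ _ _ (suc N) (λ {p} _ _ → 𝟙-mono (prime≥5? p) (prime? p) proj₁)) ⟩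
    sumTo (λ p → w p * q p) L + sumTo (λ i → 1 * q (L + i)) k + count prime? (suc N)
      ≡⟨ cong (λ T → sumTo (λ p → w p * q p) L + T + count prime? (suc N)) (sumTo-cong _ _ k (λ i → *-identityˡ (q (L + i)))) ⟩
    sumTo (λ p → w p * q p) L + sumTo (λ i → q (L + i)) k + count prime? (suc N) ∎
    where
    open ≤-Reasoning
    w q : ℕ → ℕ
    w p = 𝟙 (prime≥5? p)
    q p = ⌊N/36p²⌋ N p


module Density where

  open import Data.Nat
  open import Data.Nat.Properties
  open import Data.Nat.DivMod
  open import Data.Nat.Primality using (prime?)
  open import Relation.Binary.PropositionalEquality
  open import Defs
  open Sums
  open Sieve
  open Primes
  open Arithmetic
  open SieveWeight

  -- Opaque: _+_ and _*_ recurse on their first argument, so 2⁴⁰⁰⁰⁰ must never be unfolded.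
  opaque
    K : ℕ
    K = 2 ^ 40000

    K≡2^40000 : K ≡ 2 ^ 40000
    K≡2^40000 = refl

  N₀ : ℕ
  N₀ = 6400 * (K + 1)

  -- The implicit arguments are spelled out: inferring them would unfold products like 1000000 * T₁.
  37[1+N]≤250*sumTo-term : ∀ N → N₀ ≤ N → 37 * suc N ≤ 250 * sumTo term N
  37[1+N]≤250*sumTo-term N N≥N₀ =
    DensityArithmetic.37[1+N]≤250S {N} {sumTo term N} {sumTo bad36 N} {sieveWeight N}
      {sumTo (λ p → 𝟙 (prime≥5? p) * ⌊N/36p²⌋ N p) 300} {sumTo (λ i → ⌊N/36p²⌋ N (300 + i)) (suc N ∸ 300)}
      {count prime? (suc N)} {N / 36} {count (bigPrime? 40000) (suc N)} {K}
      (N≤sum-term+bad36+84*sieveWeight N) (sumTo-bad36≤ N) 36*[N/36]≤N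
      (sieveWeight≤ N 300 (suc N ∸ 300) 1+N≡300+[1+N∸300]) (small-primes≤ N) (300*large-primes≤N/36 N (suc N ∸ 300))
      primes≤ (k*count-bigPrime≤4*X {40000} (s≤s z≤n) (suc N)) N≥N₀
    where
    1+N≡300+[1+N∸300] : suc N ≡ 300 + (suc N ∸ 300)
    1+N≡300+[1+N∸300] = sym (m+[n∸m]≡n (≤-trans (≤-trans (m≤m+n 300 6100) (*-monoʳ-≤ 6400 (m≤n+m 1 K))) (m≤n⇒m≤1+n N≥N₀)))
    36*[N/36]≤N : 36 * (N / 36) ≤ N
    36*[N/36]≤N = ≤-trans (≤-reflexive (*-comm 36 (N / 36))) (m/n*n≤m N 36)
    primes≤ : count prime? (suc N) ≤ count (bigPrime? 40000) (suc N) + K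
    primes≤ = subst (λ c → count prime? (suc N) ≤ count (bigPrime? 40000) (suc N) + c) (sym K≡2^40000) (count-prime≤ 40000 (suc N))


module Infinitude where

  open import Data.Bool using (true; false)
  open import Data.List using (applyUpTo)
  open import Data.Nat
  open import Data.Nat.ListAction using (sum)
  open import Data.Nat.Properties
  open import Data.Nat.Tactic.RingSolver using (solve-∀)
  open import Data.Product using (Σ; _×_; _,_)
  open import Relation.Binary.PropositionalEquality
  open import Relation.Nullary using (contradiction)
  open import Defs
  open Sums
  open SquareFreeTest
  open Density

  sumTo-suc : ∀ f N → sumTo f (suc N) ≡ f 1 + sumTo (λ i → f (suc i)) N
  sumTo-suc f zero    = +-comm 0 (f 1)
  sumTo-suc f (suc N) = trans (cong (_+ f (2 + N)) (sumTo-suc f N)) (+-assoc (f 1) _ _)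

  sum-applyUpTo≡sumTo : ∀ f N → sum (applyUpTo (λ i → f (suc i)) N) ≡ sumTo f N
  sum-applyUpTo≡sumTo f zero    = refl
  sum-applyUpTo≡sumTo f (suc N) =
    trans (cong (f 1 +_) (sum-applyUpTo≡sumTo (λ i → f (suc i)) N)) (sym (sumTo-suc f N))

  37[1+N]≤250*Sℕ : ∀ N → N₀ ≤ N → 37 * suc N ≤ 250 * Sℕ N
  37[1+N]≤250*Sℕ N N≥N₀ = subst (λ S → 37 * suc N ≤ 250 * S) (sym (sum-applyUpTo≡sumTo term N)) (37[1+N]≤250*sumTo-term N N≥N₀)

  term≤1 : ∀ n → term n ≤ 1
  term≤1 n = *-mono-≤ (*-mono-≤ (μ²≤1 (n ^ 2 + 1)) (μ²≤1 (n ^ 2 + 2))) (μ²≤1 (n ^ 2 + 3))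
    where
    μ²≤1 : ∀ m → μ² m ≤ 1
    μ²≤1 m with squarefreeᵇ m
    ... | true  = ≤-refl
    ... | false = z≤n

  TripleSquareFree : ℕ → Set
  TripleSquareFree n = SquareFree (n ^ 2 + 1) × SquareFree (n ^ 2 + 2) × SquareFree (n ^ 2 + 3)

  term>0⇒TripleSquareFree : ∀ n → 0 < term n → TripleSquareFree n
  term>0⇒TripleSquareFree n term>0
    with squarefreeᵇ (n ^ 2 + 1) in sqf₁ | squarefreeᵇ (n ^ 2 + 2) in sqf₂ | squarefreeᵇ (n ^ 2 + 3) in sqf₃
  ... | true | true | true = sqf (s≤s z≤n) sqf₁ , sqf (s≤s z≤n) sqf₂ , sqf (s≤s z≤n) sqf₃
    where
    sqf : ∀ {a} → 0 < a → squarefreeᵇ (n ^ 2 + a) ≡ true → SquareFree (n ^ 2 + a)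
    sqf {a} a>0 = squarefreeᵇ≡true⇒SquareFree (≤-trans a>0 (m≤n+m a (n ^ 2)))

  ∃TripleSquareFree-in : ∀ N k → N₀ ≤ N + k → 250 * N < 37 * suc (N + k) → Σ ℕ (λ n → N < n × TripleSquareFree n)
  ∃TripleSquareFree-in N k N₀≤N+k 250N<37[1+N+k]
    with sumTo (λ i → term (N + i)) k in tail≡ | sumTo>0⇒∃ (λ i → term (N + i)) k
  ... | zero  | _ = contradiction (begin
    37 * suc (N + k)                                   ≤⟨ 37[1+N]≤250*sumTo-term (N + k) N₀≤N+k ⟩
    250 * sumTo term (N + k)                           ≡⟨ cong (250 *_) (sumTo-split term N k) ⟩
    250 * (sumTo term N + sumTo (λ i → term (N + i)) k) ≡⟨ cong (λ t → 250 * (sumTo term N + t)) tail≡ ⟩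
    250 * (sumTo term N + 0)                           ≤⟨ *-monoʳ-≤ 250 (≤-trans (≤-reflexive (+-identityʳ _)) (sumTo≤length term N term≤1)) ⟩
    250 * N                                            ∎) (<⇒≱ 250N<37[1+N+k])
    where open ≤-Reasoning
  ... | suc _ | witness with witness (s≤s z≤n)
  ...   | i , 1≤i , _ , term>0 = N + i , m<m+n N 1≤i , term>0⇒TripleSquareFree (N + i) term>0

  ∃TripleSquareFree> : ∀ N → Σ ℕ (λ n → N < n × TripleSquareFree n)
  ∃TripleSquareFree> N = ∃TripleSquareFree-in N (N₀ + 6 * N) (≤-trans (m≤m+n N₀ (6 * N)) (m≤n+m _ N)) (begin-strict
    250 * N                          <⟨ m<m+n (250 * N) (≤-trans (s≤s z≤n) (m≤n+m 37 (9 * N))) ⟩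
    250 * N + (9 * N + 37)           ≡⟨ 250*N+[9*N+37]≡37*[1+7*N] N ⟩
    37 * suc (7 * N)                 ≤⟨ *-monoʳ-≤ 37 (s≤s (+-monoʳ-≤ N (m≤n+m (6 * N) N₀))) ⟩
    37 * suc (N + (N₀ + 6 * N))      ∎)
    where
    open ≤-Reasoning
    250*N+[9*N+37]≡37*[1+7*N] : ∀ N → 250 * N + (9 * N + 37) ≡ 37 * suc (7 * N)
    250*N+[9*N+37]≡37*[1+7*N] = solve-∀


open import Defs
open import Data.Nat using (ℕ; _<_; _^_; _+_)
open import Data.Integer using (+_)
open import Data.Rational using (ℚ; _/_; floor; _*_) renaming (_<_ to _<ℚ_; _≤_ to _≤ℚ_)
open import Data.Product using (Σ; _×_; _,_)

import Data.Nat as ℕ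
import Data.Nat.Properties as ℕ
import Data.Integer as ℤ
import Data.Integer.Properties as ℤ
open import Data.Integer.DivMod using (n<s[n/ℕd]*d)
open import Data.Nat.Coprimality using (1-coprimeTo) renaming (sym to coprime-sym)
open import Data.Rational using (mkℚ)
open import Data.Rational.Base using (*≤*; *<*)
import Data.Rational.Properties as ℚ
import Data.Rational.Unnormalised.Base as ℚᵘ
import Data.Rational.Unnormalised.Properties as ℚᵘ
open import Relation.Binary.PropositionalEquality
open import Relation.Nullary using (yes; no; contradiction)
open Density using (N₀)
open Infinitude using (37[1+N]≤250*Sℕ; ∃TripleSquareFree>)

n/1≡mkℚ : ∀ n → + n / 1 ≡ mkℚ (+ n) 0 (coprime-sym (1-coprimeTo n))
n/1≡mkℚ n = ℚ.normalize-coprime (coprime-sym (1-coprimeTo n))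

floor-bounds : ∀ M X → + M / 1 ≤ℚ X → Σ ℕ (λ N → floor X ≡ + N × M ℕ.≤ N × X <ℚ + ℕ.suc N / 1)
floor-bounds M X@(mkℚ n d _) M≤X = go (n ℤ./ℕ ℕ.suc d) refl
  where
  D : ℤ.ℤ
  D = + ℕ.suc d
  M*D≤n : + M ℤ.* D ℤ.≤ n ℤ.* + 1
  M*D≤n = ℚ.drop-*≤* (subst (_≤ℚ X) (n/1≡mkℚ M) M≤X)
  n<[1+⌊n/D⌋]*D : n ℤ.< ℤ.suc (n ℤ./ℕ ℕ.suc d) ℤ.* D
  n<[1+⌊n/D⌋]*D = n<s[n/ℕd]*d n (ℕ.suc d)
  0≤n : + 0 ℤ.≤ n
  0≤n = ℤ.≤-trans (ℤ.*-monoʳ-≤-nonNeg D (ℤ.+≤+ (ℕ.z≤n {M}))) (subst (+ M ℤ.* D ℤ.≤_) (ℤ.*-identityʳ n) M*D≤n)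
  go : ∀ q → n ℤ./ℕ ℕ.suc d ≡ q → Σ ℕ (λ N → floor X ≡ + N × M ℕ.≤ N × X <ℚ + ℕ.suc N / 1)
  go (+ N) ⌊n/D⌋≡N = N , trans (ℤ.*-identityˡ _) ⌊n/D⌋≡N , M≤N , subst (X <ℚ_) (sym (n/1≡mkℚ (ℕ.suc N))) (*<* n*1<[1+N]*D)
    where
    n*1<[1+N]*D : n ℤ.* + 1 ℤ.< + ℕ.suc N ℤ.* D
    n*1<[1+N]*D = subst₂ ℤ._<_ (sym (ℤ.*-identityʳ n)) (cong (λ q → ℤ.suc q ℤ.* D) ⌊n/D⌋≡N) n<[1+⌊n/D⌋]*D
    M≤N : M ℕ.≤ N
    M≤N with M ℕ.≤? N
    ... | yes M≤N = M≤N
    ... | no  M≰N = contradiction (ℤ.≤-<-trans M*D≤n n*1<[1+N]*D) (ℤ.≤⇒≯ (ℤ.*-monoʳ-≤-nonNeg D (ℤ.+≤+ (ℕ.≰⇒> M≰N))))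
  go ℤ.-[1+ q ] ⌊n/D⌋≡-1-q = contradiction
    (ℤ.≤-<-trans 0≤n (ℤ.<-≤-trans (subst (λ r → n ℤ.< ℤ.suc r ℤ.* D) ⌊n/D⌋≡-1-q n<[1+⌊n/D⌋]*D) (nonPos q)))
    (ℤ.<-irrefl refl)
    where
    nonPos : ∀ q → ℤ.suc ℤ.-[1+ q ] ℤ.* D ℤ.≤ + 0
    nonPos ℕ.zero    = ℤ.≤-refl
    nonPos (ℕ.suc q) = ℤ.-≤+

α : ℚ
α = + 37 / 250

-- 1477 · 250 < 37 · 10000
1477/10000<α : + 1477 / 10000 <ℚ α
1477/10000<α = *<* (ℤ.+<+ (ℕ.≤ᵇ⇒≤ 369251 370000 _))

α*[1+N]≤S : ∀ N S → 37 ℕ.* ℕ.suc N ℕ.≤ 250 ℕ.* S → α * (+ ℕ.suc N / 1) ≤ℚ + S / 1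
α*[1+N]≤S N S 37[1+N]≤250S rewrite n/1≡mkℚ (ℕ.suc N) | n/1≡mkℚ S =
  ℚ.toℚᵘ-cancel-≤ (ℚᵘ.≤-respˡ-≃ (ℚᵘ.≃-sym (ℚ.toℚᵘ-homo-* α (mkℚ (+ ℕ.suc N) 0 (coprime-sym (1-coprimeTo (ℕ.suc N))))))
                                  (ℚᵘ.*≤* 37[1+N]*1≤S*250))
  where
  37[1+N]*1≤S*250 : + (37 ℕ.* ℕ.suc N ℕ.* 1) ℤ.≤ + S ℤ.* + 250
  37[1+N]*1≤S*250 = subst (+ (37 ℕ.* ℕ.suc N ℕ.* 1) ℤ.≤_) (ℤ.pos-* S 250)
                          (ℤ.+≤+ (subst₂ ℕ._≤_ (sym (ℕ.*-identityʳ _)) (ℕ.*-comm 250 S) 37[1+N]≤250S))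

αX<S⌊X⌋ : ∀ X → + N₀ / 1 ≤ℚ X → α * X <ℚ + Sℤ (floor X) / 1
αX<S⌊X⌋ X N₀≤X with floor-bounds N₀ X N₀≤X
... | N , ⌊X⌋≡N , N₀≤N , X<1+N = subst (λ z → α * X <ℚ + Sℤ z / 1) (sym ⌊X⌋≡N)
  (ℚ.<-≤-trans (ℚ.*-monoʳ-<-pos α X<1+N) (α*[1+N]≤S N (Sℕ N) (37[1+N]≤250*Sℕ N N₀≤N)))

mainTheorem3 : Σ ℚ (λ α → ((+ 1477) / 10000 <ℚ α) ×
    Σ ℚ (λ X₀ → ∀ (X : ℚ) → X₀ ≤ℚ X → α * X <ℚ ((+ Sℤ (floor X)) / 1)))
    × (∀ (N : ℕ) → Σ ℕ (λ n → (N < n) × SquareFree (n ^ 2 + 1) × SquareFree (n ^ 2 + 2) × SquareFree (n ^ 2 + 3)))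
mainTheorem3 = (α , 1477/10000<α , + N₀ / 1 , αX<S⌊X⌋) , ∃TripleSquareFree>
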